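{- For an oracle $A$ the following are equivalent: (i) $A$ computes a trace that traces every computable function; (ii) $A$ computes a partial trace that traces every computable function.
   Context: A trace (slalom) computable in $A$ is a function $\sigma$ from $\omega$ to finite subsets of $\omega$ with $|\sigma(n)|\le n$ for all $n$ such that $\sigma(n)=D_{p(n)}$ for some $p\le_T A$, where $D_k$ is the $k$-th finite set in a canonical enumeration; $\sigma$ traces $f:\omega\to\omega$ if $f(n)\in\sigma(n)$ for almost all $n$. A partial trace computed by $A$ is given by an infinite set $D\subseteq\omega$ that is c.e. in $A$, a partial $A$-computable function $g$ dominating the identity with $D\subseteq\mathrm{dom}(g)$, and a partial $A$-computable function $\sigma$ from $D$ to finite subsets of $\omega$ with $|\sigma(n)|<g(n)$ for all $n\in D$; it traces $f:\omega\to\omega$ if $f(n)\in\sigma(n)$ for all but finitely many $n\in D$. -}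

module Defs where

open import Data.Nat using (ℕ; zero; suc; _+_; _≤_; _<_)
open import Data.Nat.DivMod using (_/_; _%_)
open import Data.Bool using (Bool; true; false; if_then_else_)
open import Data.Fin using (Fin)
open import Data.Vec using (Vec; []; _∷_; lookup)
open import Data.Product using (Σ; ∃; _×_; _,_)
open import Relation.Binary.PropositionalEquality using (_≡_)

Oracle : Set
Oracle = ℕ → Bool

-- Partial recursive functions relative to an oracle (μ-recursive codes).
-- Code n = code of an n-ary partial function.

data Code : ℕ → Set where
  zer  : ∀ {n} → Code n
  succ : Code 1
  proj : ∀ {n} → Fin n → Code n
  orc  : Code 1
  comp : ∀ {m n} → Code m → Vec (Code n) m → Code n
  prim : ∀ {n} → Code n → Code (suc (suc n)) → Code (suc n)
  mu   : ∀ {n} → Code (suc n) → Code n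

-- Big-step semantics: Eval A c xs y  means  c^A(xs) converges with value y.
data Eval (A : Oracle) : ∀ {n} → Code n → Vec ℕ n → ℕ → Set
data EvalV (A : Oracle) : ∀ {m n} → Vec (Code n) m → Vec ℕ n → Vec ℕ m → Set

data Eval A where
  zerE  : ∀ {n} {xs : Vec ℕ n} → Eval A zer xs 0
  succE : ∀ {x} → Eval A succ (x ∷ []) (suc x)
  projE : ∀ {n} {xs : Vec ℕ n} (i : Fin n) → Eval A (proj i) xs (lookup xs i)
  orcE  : ∀ {x} → Eval A orc (x ∷ []) (if A x then 1 else 0)
  compE : ∀ {m n} {f : Code m} {gs : Vec (Code n) m} {xs ys y} →
          EvalV A gs xs ys → Eval A f ys y → Eval A (comp f gs) xs y
  primZ : ∀ {n} {f : Code n} {g} {xs y} →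
          Eval A f xs y → Eval A (prim f g) (0 ∷ xs) y
  primS : ∀ {n} {f : Code n} {g} {xs k r y} →
          Eval A (prim f g) (k ∷ xs) r → Eval A g (k ∷ r ∷ xs) y →
          Eval A (prim f g) (suc k ∷ xs) y
  muE   : ∀ {n} {f : Code (suc n)} {xs k} →
          Eval A f (k ∷ xs) 0 →
          (∀ j → j < k → Σ ℕ λ v → Eval A f (j ∷ xs) (suc v)) →
          Eval A (mu f) xs k

data EvalV A where
  []E  : ∀ {n} {xs : Vec ℕ n} → EvalV A [] xs []
  _∷E_ : ∀ {m n} {g : Code n} {gs : Vec (Code n) m} {xs y ys} →
         Eval A g xs y → EvalV A gs xs ys → EvalV A (g ∷ gs) xs (y ∷ ys)

_⟨_⟩[_]≃_ : Code 1 → Oracle → ℕ → ℕ → Set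
e ⟨ A ⟩[ x ]≃ y = Eval A e (x ∷ []) y

Converges : Oracle → Code 1 → ℕ → Set
Converges A e x = Σ ℕ λ y → e ⟨ A ⟩[ x ]≃ y

ComputableIn : Oracle → (ℕ → ℕ) → Set
ComputableIn A f = Σ (Code 1) λ e → ∀ x → e ⟨ A ⟩[ x ]≃ f x

∅ : Oracle
∅ _ = false

Computable : (ℕ → ℕ) → Set
Computable f = ComputableIn ∅ f

CEIn : Oracle → (ℕ → Set) → Set
CEIn A D = Σ (Code 1) λ e → ∀ x → (D x → Converges A e x) × (Converges A e x → D x)

Infinite : (ℕ → Set) → Set
Infinite D = ∀ m → Σ ℕ λ n → m ≤ n × D n

-- Canonical enumeration of finite sets: D_k = { m | bit m of k is 1 }.

bit : ℕ → ℕ → ℕ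
bit zero    k = k % 2
bit (suc m) k = bit m (k / 2)

_∈D_ : ℕ → ℕ → Set
m ∈D k = bit m k ≡ 1

-- |D_k| = number of 1-bits of k (fuel k suffices since k < 2^k)
popcount′ : ℕ → ℕ → ℕ
popcount′ zero    k = 0
popcount′ (suc f) k = k % 2 + popcount′ f (k / 2)

∣D_∣ : ℕ → ℕ
∣D k ∣ = popcount′ k k

-- σ(n) = D_{p(n)}; σ traces f if f(n) ∈ σ(n) for almost all n.
TracesTotal : (ℕ → ℕ) → (ℕ → ℕ) → Set
TracesTotal p f = Σ ℕ λ N → ∀ n → N ≤ n → f n ∈D p n

ComputesTraceForAllComputable : Oracle → Set
ComputesTraceForAllComputable A =
  Σ (ℕ → ℕ) λ p →
    ComputableIn A p ×
    (∀ n → ∣D p n ∣ ≤ n) ×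
    (∀ f → Computable f → TracesTotal p f)

record PartialTrace (A : Oracle) : Set₁ where
  field
    D       : ℕ → Set
    D-inf   : Infinite D
    D-ce    : CEIn A D
    g       : Code 1
    g-dom   : ∀ n y → g ⟨ A ⟩[ n ]≃ y → n ≤ y
    D⊆domg  : ∀ n → D n → Converges A g n
    σ       : Code 1
    D⊆domσ  : ∀ n → D n → Converges A σ n
    σ-bound : ∀ n → D n → ∀ k y → σ ⟨ A ⟩[ n ]≃ k → g ⟨ A ⟩[ n ]≃ y → ∣D k ∣ < y

TracesPartial : ∀ {A} → PartialTrace A → (ℕ → ℕ) → Set
TracesPartial {A} T f =
  Σ ℕ λ N → ∀ n → N ≤ n → D n → ∀ k → σ ⟨ A ⟩[ n ]≃ k → f n ∈D k
  where open PartialTrace T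

ComputesPartialTraceForAllComputable : Oracle → Set₁
ComputesPartialTraceForAllComputable A =
  Σ (PartialTrace A) λ T → ∀ f → Computable f → TracesPartial T f

-- (i) ⇒ (ii) is immediate: a trace is a partial trace with D = ℕ, g(n) = n+1.
-- (ii) ⇒ (i): from the partial trace (D, g, σ) choose A-computably m(n) ≥ n
-- in D and let d(n) = σ(m(n)); members of the finite set D_{d(n)} are below
-- d(n).  The trace p(n) lists the values φ_e(n), e < n, whose computation has
-- a certificate w ≤ d(n); there are at most n of them.  For computable f = φ_e
-- the prefix sums F of the least certificates of f(0), f(1), … are computable,
-- so F(m) ∈ σ(m) for almost all m ∈ D; hence the certificate of f(n) is at
-- most F(m(n)) < d(n) and f(n) ∈ p(n) for all large n.
--
-- Certificates form a Kleene normal form: a total arithmetic predicate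
-- checkF w e x, compiled into a code, holds iff w encodes a value y and a
-- list of valid judgements deriving φ_e(x) = y.
module Submission where

open import Defs
open import Data.Product using (_,_)
open import Function.Bundles using (_⇔_; mk⇔)

module Expressions where

  open import Data.Nat
  open import Data.Nat.Properties using (pred[m∸n]≡m∸[1+n])
  open import Data.Fin using (Fin; zero; suc)
  open import Data.Vec using (Vec; []; _∷_; lookup; tabulate)
  open import Data.Vec.Properties using (tabulate∘lookup)
  open import Function using (_∘_)
  open import Relation.Binary.PropositionalEquality using (subst)

  ifzF : ℕ → ℕ → ℕ → ℕ
  ifzF zero    a b = a
  ifzF (suc _) a b = b

  recF : ℕ → (ℕ → ℕ → ℕ) → ℕ → ℕ
  recF b s zero    = b
  recF b s (suc k) = s k (recF b s k)

  -- Besides the usual operations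
  -- they may query the oracle ('orac') and call one fixed ternary function
  -- ('call'), which lets a compiled program be reused inside later ones.
  data Expr : ℕ → Set where
    var         : ∀ {n} → Fin n → Expr n
    lit         : ∀ {n} → ℕ → Expr n
    add mul sub : ∀ {n} → Expr n → Expr n → Expr n
    ifz         : ∀ {n} → Expr n → Expr n → Expr n → Expr n
    orac        : ∀ {n} → Expr n → Expr n
    app         : ∀ {n k} → Expr k → Vec (Expr n) k → Expr n
    rec         : ∀ {n} → Expr n → Expr (suc (suc n)) → Expr n → Expr n
    call        : ∀ {n} → Expr n → Expr n → Expr n → Expr n

  module Semantics (o : ℕ → ℕ) (h : ℕ → ℕ → ℕ → ℕ) where
    sem  : ∀ {n} → Expr n → Vec ℕ n → ℕ
    semV : ∀ {n k} → Vec (Expr n) k → Vec ℕ n → Vec ℕ k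
    sem (var i)      xs = lookup xs i
    sem (lit k)      xs = k
    sem (add a b)    xs = sem a xs + sem b xs
    sem (mul a b)    xs = sem a xs * sem b xs
    sem (sub a b)    xs = sem a xs ∸ sem b xs
    sem (ifz c a b)  xs = ifzF (sem c xs) (sem a xs) (sem b xs)
    sem (orac a)     xs = o (sem a xs)
    sem (app g es)   xs = sem g (semV es xs)
    sem (rec b s k)  xs = recF (sem b xs) (λ i r → sem s (i ∷ r ∷ xs)) (sem k xs)
    sem (call a b c) xs = h (sem a xs) (sem b xs) (sem c xs)
    semV []       xs = []
    semV (e ∷ es) xs = sem e xs ∷ semV es xs

  addC : Code 2
  addC = prim (proj zero) (comp succ (proj (suc zero) ∷ []))

  mulC : Code 2
  mulC = prim zer (comp addC (proj (suc (suc zero)) ∷ proj (suc zero) ∷ []))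

  predC : Code 1
  predC = prim zer (proj zero)

  -- note the argument order: subC (y, x) = x ∸ y
  subC : Code 2
  subC = prim (proj zero) (comp predC (proj (suc zero) ∷ []))

  ifzC : Code 3
  ifzC = prim (proj zero) (proj (suc (suc (suc zero))))

  litC : ∀ {n} → ℕ → Code n
  litC zero    = zer
  litC (suc k) = comp succ (litC k ∷ [])

  idC : ∀ {n} → Vec (Code n) n
  idC = tabulate proj

  module _ (A : Oracle) where
    addEv : ∀ x y → Eval A addC (x ∷ y ∷ []) (x + y)
    addEv zero    y = primZ (projE zero)
    addEv (suc x) y = primS (addEv x y) (compE (projE (suc zero) ∷E []E) succE)

    mulEv : ∀ x y → Eval A mulC (x ∷ y ∷ []) (x * y)
    mulEv zero    y = primZ zerE
    mulEv (suc x) y =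
      primS (mulEv x y) (compE (projE _ ∷E (projE _ ∷E []E)) (addEv y (x * y)))

    predEv : ∀ x → Eval A predC (x ∷ []) (pred x)
    predEv zero    = primZ zerE
    predEv (suc x) = primS (predEv x) (projE zero)

    subEv : ∀ y x → Eval A subC (y ∷ x ∷ []) (x ∸ y)
    subEv zero    x = primZ (projE zero)
    subEv (suc y) x = subst (Eval A subC (suc y ∷ x ∷ [])) (pred[m∸n]≡m∸[1+n] x y)
      (primS (subEv y x) (compE (projE (suc zero) ∷E []E) (predEv (x ∸ y))))

    ifzEv : ∀ c a b → Eval A ifzC (c ∷ a ∷ b ∷ []) (ifzF c a b)
    ifzEv zero    a b = primZ (projE zero)
    ifzEv (suc c) a b = primS (ifzEv c a b) (projE _)

    litEv : ∀ {n} k (xs : Vec ℕ n) → Eval A (litC k) xs k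
    litEv zero    xs = zerE
    litEv (suc k) xs = compE (litEv k xs ∷E []E) succE

    idEv : ∀ {n} (xs : Vec ℕ n) → EvalV A idC xs xs
    idEv xs = subst (EvalV A idC xs) (tabulate∘lookup xs) (go (λ i → i))
      where
        go : ∀ {m} (f : Fin m → Fin _) →
             EvalV A (tabulate (proj ∘ f)) xs (tabulate (lookup xs ∘ f))
        go {zero}  f = []E
        go {suc m} f = projE (f zero) ∷E go (f ∘ suc)

  module Compile (O : Code 1) (H : Code 3) where
    compile  : ∀ {n} → Expr n → Code n
    compileV : ∀ {n k} → Vec (Expr n) k → Vec (Code n) k
    compile (var i)      = proj i
    compile (lit k)      = litC k
    compile (add a b)    = comp addC (compile a ∷ compile b ∷ [])
    compile (mul a b)    = comp mulC (compile a ∷ compile b ∷ [])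
    compile (sub a b)    = comp subC (compile b ∷ compile a ∷ [])
    compile (ifz c a b)  = comp ifzC (compile c ∷ compile a ∷ compile b ∷ [])
    compile (orac a)     = comp O (compile a ∷ [])
    compile (app g es)   = comp (compile g) (compileV es)
    compile (rec b s k)  = comp (prim (compile b) (compile s)) (compile k ∷ idC)
    compile (call a b c) = comp H (compile a ∷ compile b ∷ compile c ∷ [])
    compileV []       = []
    compileV (e ∷ es) = compile e ∷ compileV es

  module CompileCorrect (A : Oracle)
      (O : Code 1) (o : ℕ → ℕ) (O-ev : ∀ x → Eval A O (x ∷ []) (o x))
      (H : Code 3) (h : ℕ → ℕ → ℕ → ℕ)
      (H-ev : ∀ a b c → Eval A H (a ∷ b ∷ c ∷ []) (h a b c)) where
    open Semantics o h
    open Compile O H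

    compileEv  : ∀ {n} (e : Expr n) (xs : Vec ℕ n) → Eval A (compile e) xs (sem e xs)
    compileEvV : ∀ {n k} (es : Vec (Expr n) k) (xs : Vec ℕ n) →
                 EvalV A (compileV es) xs (semV es xs)
    recEv      : ∀ {n} (b : Expr n) (s : Expr (suc (suc n))) (xs : Vec ℕ n) k →
                 Eval A (prim (compile b) (compile s)) (k ∷ xs)
                   (recF (sem b xs) (λ i r → sem s (i ∷ r ∷ xs)) k)
    compileEv (var i)      xs = projE i
    compileEv (lit k)      xs = litEv A k xs
    compileEv (add a b)    xs = compE (compileEv a xs ∷E (compileEv b xs ∷E []E)) (addEv A _ _)
    compileEv (mul a b)    xs = compE (compileEv a xs ∷E (compileEv b xs ∷E []E)) (mulEv A _ _)
    compileEv (sub a b)    xs = compE (compileEv b xs ∷E (compileEv a xs ∷E []E)) (subEv A _ _)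
    compileEv (ifz c a b)  xs =
      compE (compileEv c xs ∷E (compileEv a xs ∷E (compileEv b xs ∷E []E))) (ifzEv A _ _ _)
    compileEv (orac a)     xs = compE (compileEv a xs ∷E []E) (O-ev _)
    compileEv (app g es)   xs = compE (compileEvV es xs) (compileEv g _)
    compileEv (rec b s k)  xs = compE (compileEv k xs ∷E idEv A xs) (recEv b s xs (sem k xs))
    compileEv (call a b c) xs =
      compE (compileEv a xs ∷E (compileEv b xs ∷E (compileEv c xs ∷E []E))) (H-ev _ _ _)
    compileEvV []       xs = []E
    compileEvV (e ∷ es) xs = compileEv e xs ∷E compileEvV es xs
    recEv b s xs zero    = primZ (compileEv b xs)
    recEv b s xs (suc k) = primS (recEv b s xs k) (compileEv s _)

-- Cantor pairing of natural numbers.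
module Pairing where

  open import Data.Nat
  open import Data.Nat.Properties
  open import Data.Product using (_×_; _,_; proj₁; proj₂)
  open import Data.Empty using (⊥-elim)
  open import Relation.Binary.PropositionalEquality
  open import Relation.Binary.Definitions using (tri<; tri≈; tri>)
  open Expressions using (ifzF; recF)

  -- Cantor pairing  pairF a b = triF (a + b) + b  and its inverse, all defined
  -- by iteration so that they are directly expressible as expressions.  The
  -- definitions are opaque: later proofs only use the properties below.
  opaque
    triF : ℕ → ℕ
    triF s = recF 0 (λ i r → r + suc i) s

    pairF : ℕ → ℕ → ℕ
    pairF a b = triF (a + b) + b

    -- diagF z is the diagonal of z: the unique s with triF s ≤ z < triF (s + 1)
    diagF : ℕ → ℕ
    diagF z = recF 0 (λ i r → ifzF (triF (suc r) ∸ suc i) (suc r) r) z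

    sndF : ℕ → ℕ
    sndF z = z ∸ triF (diagF z)

    fstF : ℕ → ℕ
    fstF z = diagF z ∸ sndF z

    OnDiagonal : ℕ → ℕ → Set
    OnDiagonal z s = triF s ≤ z × z < triF (suc s)

    tri-mono : ∀ {m n} → m ≤ n → triF m ≤ triF n
    tri-mono {m}     {zero}  z≤n     = ≤-refl
    tri-mono {zero}  {suc n} h       = z≤n
    tri-mono {suc m} {suc n} (s≤s h) = +-mono-≤ (tri-mono h) (s≤s h)

    n≤tri : ∀ s → s ≤ triF s
    n≤tri zero    = z≤n
    n≤tri (suc s) = m≤n+m (suc s) (triF s)

    diag-step : ∀ i r → OnDiagonal i r →
                OnDiagonal (suc i) (ifzF (triF (suc r) ∸ suc i) (suc r) r)
    diag-step i r (lo , hi) with triF (suc r) ∸ suc i in eq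
    ... | zero  = m∸n≡0⇒m≤n eq
                , ≤-trans (s≤s hi) (m<m+n (triF (suc r)) {suc (suc r)} (s≤s z≤n))
    ... | suc k = ≤-trans lo (n≤1+n i)
                , m∸n≢0⇒n<m {triF (suc r)} {suc i} (λ e → 0≢1+n (trans (sym e) eq))

    diag-correct : ∀ z → OnDiagonal z (diagF z)
    diag-correct zero    = z≤n , s≤s z≤n
    diag-correct (suc i) = diag-step i (diagF i) (diag-correct i)

    diagonal-unique : ∀ {z s t} → OnDiagonal z s → OnDiagonal z t → s ≡ t
    diagonal-unique {z} {s} {t} (lo₁ , hi₁) (lo₂ , hi₂) with <-cmp s t
    ... | tri≈ _ e _ = e
    ... | tri< s<t _ _ = ⊥-elim (<-irrefl refl (<-≤-trans hi₁ (≤-trans (tri-mono s<t) lo₂)))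
    ... | tri> _ _ t<s = ⊥-elim (<-irrefl refl (<-≤-trans hi₂ (≤-trans (tri-mono t<s) lo₁)))

    diag-pair : ∀ a b → diagF (pairF a b) ≡ a + b
    diag-pair a b = diagonal-unique (diag-correct (pairF a b))
      (m≤m+n _ _ , +-monoʳ-< (triF (a + b)) (s≤s (m≤n+m b a)))

    snd-pair : ∀ a b → sndF (pairF a b) ≡ b
    snd-pair a b rewrite diag-pair a b = m+n∸m≡n (triF (a + b)) b

    fst-pair : ∀ a b → fstF (pairF a b) ≡ a
    fst-pair a b rewrite snd-pair a b | diag-pair a b = m+n∸n≡m a b

    snd≤diag : ∀ z → sndF z ≤ diagF z
    snd≤diag z = ≤-pred (subst (z ∸ triF s <_) (m+n∸m≡n (triF s) (suc s))
      (∸-monoˡ-< {z} {triF s} {triF s + suc s}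
                 (proj₂ (diag-correct z)) (proj₁ (diag-correct z))))
      where s : ℕ
            s = diagF z

    pair-fst-snd : ∀ z → pairF (fstF z) (sndF z) ≡ z
    pair-fst-snd z rewrite m∸n+n≡m (snd≤diag z) = m+[n∸m]≡n (proj₁ (diag-correct z))

    snd≤pair : ∀ a b → b ≤ pairF a b
    snd≤pair a b = m≤n+m b _

    snd≤ : ∀ z → sndF z ≤ z
    snd≤ z = m∸n≤m z (triF (diagF z))

    fst≤ : ∀ z → fstF z ≤ z
    fst≤ z = ≤-trans (m∸n≤m (diagF z) (sndF z))
                     (≤-trans (n≤tri (diagF z)) (proj₁ (diag-correct z)))

    fst0 : fstF 0 ≡ 0
    fst0 = refl

    snd0 : sndF 0 ≡ 0
    snd0 = refl

-- Numbers as truth values, bounded quantifiers and search, minimisation.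
module Truth where

  open import Data.Nat
  open import Data.Nat.Properties
  open import Data.Product using (Σ; _×_; _,_; proj₁; proj₂)
  open import Data.Sum using (inj₁; inj₂)
  open import Data.Empty using (⊥-elim)
  open import Data.Vec using (_∷_)
  open import Relation.Nullary using (yes; no)
  open import Relation.Binary.PropositionalEquality
  open import Relation.Binary.Definitions using (tri<; tri≈; tri>)
  open Expressions using (ifzF; recF)

  -- Numbers as truth values: a number is "true" when it is nonzero.  The
  -- connectives and tests below are arithmetic, hence expressible.
  opaque
    andF : ℕ → ℕ → ℕ
    andF a b = a * b

    and-intro : ∀ {a b} → a ≢ 0 → b ≢ 0 → andF a b ≢ 0
    and-intro {zero}          ha hb = ⊥-elim (ha refl)
    and-intro {suc a} {zero}  ha hb = ⊥-elim (hb refl)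
    and-intro {suc a} {suc b} ha hb = λ ()

    and-l : ∀ {a b} → andF a b ≢ 0 → a ≢ 0
    and-l {zero}  h = λ _ → h refl
    and-l {suc a} h = λ ()

    and-r : ∀ {a b} → andF a b ≢ 0 → b ≢ 0
    and-r {a} {zero}  h = λ _ → h (*-zeroʳ a)
    and-r {a} {suc b} h = λ ()

    eqF : ℕ → ℕ → ℕ
    eqF x y = ifzF ((x ∸ y) + (y ∸ x)) 1 0

    eq-refl : ∀ x → eqF x x ≡ 1
    eq-refl x rewrite n∸n≡0 x = refl

    eq-intro : ∀ x → eqF x x ≢ 0
    eq-intro x rewrite eq-refl x = λ ()

    eq-elim : ∀ x y → eqF x y ≢ 0 → x ≡ y
    eq-elim x y h with (x ∸ y) + (y ∸ x) in e
    ... | suc _ = ⊥-elim (h refl)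
    ... | zero  = ≤-antisym (m∸n≡0⇒m≤n (m+n≡0⇒m≡0 _ e))
                            (m∸n≡0⇒m≤n (m+n≡0⇒n≡0 (x ∸ y) e))

    eq-distinct : ∀ x y → x ≢ y → eqF x y ≡ 0
    eq-distinct x y x≢y with eqF x y in e
    ... | zero  = refl
    ... | suc _ = ⊥-elim (x≢y (eq-elim x y (λ e′ → 0≢1+n (trans (sym e′) e))))

    isZF : ℕ → ℕ
    isZF x = ifzF x 1 0

    isZ-zero : isZF 0 ≡ 1
    isZ-zero = refl

    isZ-intro : isZF 0 ≢ 0
    isZ-intro = λ ()

    isZ-elim : ∀ x → isZF x ≢ 0 → x ≡ 0
    isZ-elim zero    h = refl
    isZ-elim (suc x) h = ⊥-elim (h refl)

    isZ-nonzero : ∀ x → x ≢ 0 → isZF x ≡ 0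
    isZ-nonzero zero    h = ⊥-elim (h refl)
    isZ-nonzero (suc x) h = refl

    nzF : ℕ → ℕ
    nzF x = ifzF x 0 1

    nz-suc : ∀ v → nzF (suc v) ≢ 0
    nz-suc v = λ ()

    nz-elim : ∀ x → nzF x ≢ 0 → Σ ℕ λ v → x ≡ suc v
    nz-elim zero    h = ⊥-elim (h refl)
    nz-elim (suc x) h = x , refl

  leF : ℕ → ℕ → ℕ
  leF a b = isZF (a ∸ b)

  le-elim : ∀ a b → leF a b ≢ 0 → a ≤ b
  le-elim a b h = m∸n≡0⇒m≤n (isZ-elim (a ∸ b) h)

  le-intro : ∀ a b → a ≤ b → leF a b ≢ 0
  le-intro a b h rewrite m≤n⇒m∸n≡0 h = isZ-intro

  opaque
    -- least j < B with p j true, or B if there is none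
    bminF : (ℕ → ℕ) → ℕ → ℕ
    bminF p B = recF 0 (λ k r → ifzF (k ∸ r) (ifzF (p k) (suc k) k) r) B

    SearchedUpTo : (ℕ → ℕ) → ℕ → ℕ → Set
    SearchedUpTo p k r = r ≤ k × (∀ j → j < r → p j ≡ 0) × (r < k → p r ≢ 0)

    bmin-step : ∀ p k r → SearchedUpTo p k r →
                SearchedUpTo p (suc k) (ifzF (k ∸ r) (ifzF (p k) (suc k) k) r)
    bmin-step p k r (r≤k , below , found) with k ∸ r in e
    ... | suc _ = ≤-trans r≤k (n≤1+n k) , below
                , λ _ → found (m∸n≢0⇒n<m (λ e′ → 0≢1+n (trans (sym e′) e)))
    ... | zero with ≤-antisym r≤k (m∸n≡0⇒m≤n e)
    ... | refl with p r in pr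
    ... | suc _ = n≤1+n r , below , λ _ e′ → 0≢1+n (trans (sym e′) pr)
    ... | zero  = ≤-refl , below′ , λ r<r → ⊥-elim (<-irrefl refl r<r)
      where
        below′ : ∀ j → j < suc r → p j ≡ 0
        below′ j (s≤s j≤r) with m≤n⇒m<n∨m≡n j≤r
        ... | inj₁ j<r  = below j j<r
        ... | inj₂ refl = pr

    bmin-correct : ∀ p B → SearchedUpTo p B (bminF p B)
    bmin-correct p zero    = z≤n , (λ j ()) , λ ()
    bmin-correct p (suc B) = bmin-step p B (bminF p B) (bmin-correct p B)

    bmin-below : ∀ p B j → j < bminF p B → p j ≡ 0
    bmin-below p B = proj₁ (proj₂ (bmin-correct p B))

    bmin-found : ∀ p B → bminF p B < B → p (bminF p B) ≢ 0
    bmin-found p B = proj₂ (proj₂ (bmin-correct p B))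

    bmin-least : ∀ p B j → p j ≢ 0 → bminF p B ≤ j
    bmin-least p B j pj with bminF p B ≤? j
    ... | yes h = h
    ... | no h  = ⊥-elim (pj (bmin-below p B j (≰⇒> h)))

    bmin-lt : ∀ p B j → j < B → p j ≢ 0 → bminF p B < B
    bmin-lt p B j j<B pj = ≤-<-trans (bmin-least p B j pj) j<B

    bmin-unique : ∀ p B m → m < B → p m ≢ 0 → (∀ j → j < m → p j ≡ 0) →
                  bminF p B ≡ m
    bmin-unique p B m m<B pm below with <-cmp (bminF p B) m
    ... | tri≈ _ e _ = e
    ... | tri< lt _ _ = ⊥-elim (bmin-found p B (<-trans lt m<B) (below _ lt))
    ... | tri> _ _ gt = ⊥-elim (<-irrefl refl (<-≤-trans gt (bmin-least p B m pm)))

    bexF : (ℕ → ℕ) → ℕ → ℕ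
    bexF p B = recF 0 (λ k r → ifzF (p k) r 1) B

    bex-suc : ∀ p n → bexF p (suc n) ≡ ifzF (p n) (bexF p n) 1
    bex-suc p n = refl

    bex-zero : ∀ p → bexF p 0 ≡ 0
    bex-zero p = refl

    bex≤1 : ∀ p n → bexF p n ≤ 1
    bex≤1 p zero = z≤n
    bex≤1 p (suc n) with p n
    ... | zero  = bex≤1 p n
    ... | suc _ = ≤-refl

    bex-intro : ∀ p B j → j < B → p j ≢ 0 → bexF p B ≢ 0
    bex-intro p (suc B) j (s≤s j≤B) pj with p B in e
    ... | suc _ = λ ()
    ... | zero with m≤n⇒m<n∨m≡n j≤B
    ... | inj₁ lt   = bex-intro p B j lt pj
    ... | inj₂ refl = ⊥-elim (pj e)

    bex-elim : ∀ p B → bexF p B ≢ 0 → Σ ℕ λ j → j < B × p j ≢ 0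
    bex-elim p zero h = ⊥-elim (h refl)
    bex-elim p (suc B) h with p B in e
    ... | suc _ = B , ≤-refl , λ e′ → 0≢1+n (trans (sym e′) e)
    ... | zero with bex-elim p B h
    ... | j , lt , pj = j , ≤-trans lt (n≤1+n B) , pj

    ballF : (ℕ → ℕ) → ℕ → ℕ
    ballF p B = recF 1 (λ k r → ifzF (p k) 0 r) B

    ball-intro : ∀ p B → (∀ j → j < B → p j ≢ 0) → ballF p B ≢ 0
    ball-intro p zero h = λ ()
    ball-intro p (suc B) h with p B in e
    ... | zero  = ⊥-elim (h B ≤-refl e)
    ... | suc _ = ball-intro p B (λ j lt → h j (≤-trans lt (n≤1+n B)))

    ball-elim : ∀ p B → ballF p B ≢ 0 → ∀ j → j < B → p j ≢ 0
    ball-elim p (suc B) h j (s≤s j≤B) with p B in e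
    ... | zero = ⊥-elim (h refl)
    ... | suc _ with m≤n⇒m<n∨m≡n j≤B
    ... | inj₁ lt   = ball-elim p B h j lt
    ... | inj₂ refl = λ e′ → 0≢1+n (trans (sym e′) e)

  bmin-witness : ∀ p z → p z ≢ 0 → p (bminF p (suc z)) ≢ 0
  bmin-witness p z pz = bmin-found p (suc z) (bmin-lt p (suc z) z ≤-refl pz)

  bex-true : ∀ p B → bexF p B ≢ 0 → bexF p B ≡ 1
  bex-true p B h with bexF p B | bex≤1 p B
  ... | zero     | _        = ⊥-elim (h refl)
  ... | suc zero | _        = refl
  ... | suc (suc _) | s≤s ()

  minimisationEv : ∀ A {n} (c : Code (suc n)) xs (p : ℕ → ℕ) →
                   (∀ j → Eval A c (j ∷ xs) (isZF (p j))) →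
                   ∀ z → p z ≢ 0 → Eval A (mu c) xs (bminF p (suc z))
  minimisationEv A c xs p decides z pz =
    muE (subst (Eval A c (k ∷ xs)) (isZ-nonzero (p k) (bmin-witness p z pz)) (decides k))
        (λ j j<k → 0 , subst (Eval A c (j ∷ xs))
                             (trans (cong isZF (bmin-below p (suc z) j j<k)) isZ-zero)
                             (decides j))
    where
      k : ℕ
      k = bminF p (suc z)

-- Codes of finite sequences of numbers.
module Sequences where

  open import Data.Nat
  open import Data.Nat.Properties
  open import Data.Product using (Σ; _×_; _,_)
  open import Data.Sum using (_⊎_; inj₁; inj₂)
  open import Data.Empty using (⊥-elim)
  open import Data.Fin using (Fin; toℕ; zero; suc)
  open import Data.Vec using (Vec; []; _∷_; lookup)
  open import Data.List using (List; []; _∷_)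
  open import Data.List.Membership.Propositional using (_∈_)
  open import Data.List.Relation.Unary.Any using (here; there)
  open import Relation.Binary.PropositionalEquality
  open Expressions using (recF)
  open Pairing
  open Truth

  -- Finite sequences coded as numbers: 0 is the empty sequence and
  -- consF a l = 1 + pairF a l.  Head and tail of 0 are 0.
  consF : ℕ → ℕ → ℕ
  consF a l = suc (pairF a l)

  opaque
    hdF : ℕ → ℕ
    hdF L = fstF (L ∸ 1)

    tlF : ℕ → ℕ
    tlF L = sndF (L ∸ 1)

    hd-cons : ∀ a l → hdF (consF a l) ≡ a
    hd-cons a l = fst-pair a l

    tl-cons : ∀ a l → tlF (consF a l) ≡ l
    tl-cons a l = snd-pair a l

    cons-hd-tl : ∀ L → L ≢ 0 → consF (hdF L) (tlF L) ≡ L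
    cons-hd-tl zero    h = ⊥-elim (h refl)
    cons-hd-tl (suc x) h = cong suc (pair-fst-snd x)

    tl≤ : ∀ L → tlF L ≤ L ∸ 1
    tl≤ L = snd≤ (L ∸ 1)

    hd-empty : hdF 0 ≡ 0
    hd-empty = fst0

    tl-empty : tlF 0 ≡ 0
    tl-empty = snd0

  -- i-fold tail, i-th entry, and length (the first i with an empty i-fold tail;
  -- the search bound suc L suffices by tlI-self below)
  tlI : ℕ → ℕ → ℕ
  tlI i L = recF L (λ _ r → tlF r) i

  lookL : ℕ → ℕ → ℕ
  lookL L i = hdF (tlI i L)

  lenF : ℕ → ℕ
  lenF L = bminF (λ i → isZF (tlI i L)) (suc L)

  tlI-suc : ∀ i L → tlI (suc i) L ≡ tlI i (tlF L)
  tlI-suc zero    L = refl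
  tlI-suc (suc i) L = cong tlF (tlI-suc i L)

  tlI-empty : ∀ i → tlI i 0 ≡ 0
  tlI-empty zero    = refl
  tlI-empty (suc i) = trans (cong tlF (tlI-empty i)) tl-empty

  tlI≤ : ∀ i L → tlI i L ≤ L ∸ i
  tlI≤ zero    L = ≤-refl
  tlI≤ (suc i) L = begin
    tlF (tlI i L)  ≤⟨ tl≤ (tlI i L) ⟩
    tlI i L ∸ 1    ≤⟨ ∸-monoˡ-≤ 1 (tlI≤ i L) ⟩
    L ∸ i ∸ 1      ≡⟨ ∸-+-assoc L i 1 ⟩
    L ∸ (i + 1)    ≡⟨ cong (L ∸_) (+-comm i 1) ⟩
    L ∸ suc i      ∎
    where open ≤-Reasoning

  tlI-self : ∀ L → tlI L L ≡ 0
  tlI-self L = n≤0⇒n≡0 (≤-trans (tlI≤ L L) (≤-reflexive (n∸n≡0 L)))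

  look-cons-suc : ∀ a l j → lookL (consF a l) (suc j) ≡ lookL l j
  look-cons-suc a l j = cong hdF (trans (tlI-suc j (consF a l)) (cong (tlI j) (tl-cons a l)))

  encV : ∀ {n} → Vec ℕ n → ℕ
  encV []       = 0
  encV (x ∷ xs) = consF x (encV xs)

  encL : List ℕ → ℕ
  encL []       = 0
  encL (x ∷ xs) = consF x (encL xs)

  look-encV : ∀ {n} (xs : Vec ℕ n) (i : Fin n) → lookL (encV xs) (toℕ i) ≡ lookup xs i
  look-encV (x ∷ xs) zero    = hd-cons x (encV xs)
  look-encV (x ∷ xs) (suc i) = trans (look-cons-suc x (encV xs) (toℕ i)) (look-encV xs i)

  tlI-encV-nonempty : ∀ {n} (xs : Vec ℕ n) j → j < n → tlI j (encV xs) ≢ 0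
  tlI-encV-nonempty (x ∷ xs) zero    lt = λ ()
  tlI-encV-nonempty (x ∷ xs) (suc j) (s≤s lt)
    rewrite tlI-suc j (encV (x ∷ xs)) | tl-cons x (encV xs) = tlI-encV-nonempty xs j lt

  tlI-encV-length : ∀ {n} (xs : Vec ℕ n) → tlI n (encV xs) ≡ 0
  tlI-encV-length [] = refl
  tlI-encV-length {suc n} (x ∷ xs)
    rewrite tlI-suc n (encV (x ∷ xs)) | tl-cons x (encV xs) = tlI-encV-length xs

  length≤encV : ∀ {n} (xs : Vec ℕ n) → n ≤ encV xs
  length≤encV []       = z≤n
  length≤encV (x ∷ xs) = s≤s (≤-trans (length≤encV xs) (snd≤pair x (encV xs)))

  len-encV : ∀ {n} (xs : Vec ℕ n) → lenF (encV xs) ≡ n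
  len-encV {n} xs = bmin-unique _ _ n (s≤s (length≤encV xs))
    (subst (λ w → isZF w ≢ 0) (sym (tlI-encV-length xs)) isZ-intro)
    (λ j lt → isZ-nonzero _ (tlI-encV-nonempty xs j lt))

  vector-of-tails : ∀ m L → (∀ j → j < m → tlI j L ≢ 0) → tlI m L ≡ 0 →
                    Σ (Vec ℕ m) λ ys → encV ys ≡ L
  vector-of-tails zero    L nonempty empty = [] , sym empty
  vector-of-tails (suc m) L nonempty empty
    with vector-of-tails m (tlF L)
           (λ j lt → subst (_≢ 0) (tlI-suc j L) (nonempty (suc j) (s≤s lt)))
           (trans (sym (tlI-suc m L)) empty)
  ... | ys , e = hdF L ∷ ys
               , trans (cong (consF (hdF L)) e) (cons-hd-tl L (nonempty 0 (s≤s z≤n)))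

  len-inv : ∀ L {m} → lenF L ≡ m → Σ (Vec ℕ m) λ ys → encV ys ≡ L
  len-inv L refl = vector-of-tails (lenF L) L nonempty empty
    where
      p : ℕ → ℕ
      p i = isZF (tlI i L)
      nonempty : ∀ j → j < lenF L → tlI j L ≢ 0
      nonempty j lt z = isZ-intro (subst (λ u → isZF u ≡ 0) z (bmin-below p (suc L) j lt))
      empty : tlI (lenF L) L ≡ 0
      empty = isZ-elim _ (bmin-witness p L (subst (λ u → isZF u ≢ 0) (sym (tlI-self L)) isZ-intro))

  mem-encL : ∀ {x l} → x ∈ l → Σ ℕ λ j → j < encL l × lookL (encL l) j ≡ x
  mem-encL {x} {y ∷ l} (here refl) = 0 , s≤s z≤n , hd-cons y (encL l)
  mem-encL {x} {y ∷ l} (there m) with mem-encL m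
  ... | j , lt , e = suc j , s≤s (≤-trans lt (snd≤pair y (encL l)))
                   , trans (look-cons-suc y (encL l) j) e

  look-encL : ∀ l j → lookL (encL l) j ≡ 0 ⊎ lookL (encL l) j ∈ l
  look-encL []      j = inj₁ (trans (cong hdF (tlI-empty j)) hd-empty)
  look-encL (x ∷ l) zero = inj₂ (here (hd-cons x (encL l)))
  look-encL (x ∷ l) (suc j) rewrite look-cons-suc x (encL l) j with look-encL l j
  ... | inj₁ e = inj₁ e
  ... | inj₂ m = inj₂ (there m)

-- Gödel numbers of codes, judgements, and the arithmetic certificate checker.
module Checker where

  open import Data.Nat
  open import Data.Product using (Σ; _×_; _,_; proj₁; proj₂)
  open import Data.Fin using (Fin; toℕ; zero; suc)
  open import Data.Vec using (Vec; []; _∷_; lookup; map)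
  open import Relation.Binary.PropositionalEquality
  open Expressions using (ifzF)
  open Pairing
  open Truth
  open Sequences

  encC  : ∀ {n} → Code n → ℕ
  encCV : ∀ {n m} → Vec (Code n) m → ℕ
  encC zer         = pairF 0 0
  encC succ        = pairF 1 0
  encC (proj i)    = pairF 2 (toℕ i)
  encC orc         = pairF 3 0
  encC (comp f gs) = pairF 4 (pairF (encC f) (encCV gs))
  encC (prim f g)  = pairF 5 (pairF (encC f) (encC g))
  encC (mu f)      = pairF 6 (encC f)
  encCV []       = 0
  encCV (g ∷ gs) = consF (encC g) (encCV gs)

  encCV≡ : ∀ {n m} (gs : Vec (Code n) m) → encCV gs ≡ encV (map encC gs)
  encCV≡ []       = refl
  encCV≡ (g ∷ gs) = cong (consF (encC g)) (encCV≡ gs)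

  len-encCV : ∀ {n m} (gs : Vec (Code n) m) → lenF (encCV gs) ≡ m
  len-encCV gs = trans (cong lenF (encCV≡ gs)) (len-encV (map encC gs))

  look-encCV : ∀ {n m} (gs : Vec (Code n) m) (i : Fin m) →
               lookL (encCV gs) (toℕ i) ≡ encC (lookup gs i)
  look-encCV (g ∷ gs) zero    = hd-cons (encC g) (encCV gs)
  look-encCV (g ∷ gs) (suc i) =
    trans (look-cons-suc (encC g) (encCV gs) (toℕ i)) (look-encCV gs i)

  -- A judgement  judgF e L y  asserts that the code numbered e, applied to the
  -- argument vector coded by L, converges with value y.
  judgF : ℕ → ℕ → ℕ → ℕ
  judgF e L y = pairF e (pairF L y)

  jcodeF jargsF jvalF : ℕ → ℕ
  jcodeF J = fstF J
  jargsF J = fstF (sndF J)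
  jvalF  J = sndF (sndF J)

  jcode-judg : ∀ e L y → jcodeF (judgF e L y) ≡ e
  jcode-judg e L y = fst-pair e (pairF L y)

  jargs-judg : ∀ e L y → jargsF (judgF e L y) ≡ L
  jargs-judg e L y rewrite snd-pair e (pairF L y) = fst-pair L y

  jval-judg : ∀ e L y → jvalF (judgF e L y) ≡ y
  jval-judg e L y rewrite snd-pair e (pairF L y) = snd-pair L y

  judg-split : ∀ J → judgF (jcodeF J) (jargsF J) (jvalF J) ≡ J
  judg-split J = trans (cong (pairF (fstF J)) (pair-fst-snd (sndF J))) (pair-fst-snd J)

  -- A certificate C is the code of a list of judgements.
  memF : ℕ → ℕ → ℕ
  memF C J = bexF (λ j → eqF (lookL C j) J) C

  MemC : ℕ → ℕ → Set
  MemC C J = Σ ℕ λ j → j < C × lookL C j ≡ J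

  mem-elim : ∀ C J → memF C J ≢ 0 → MemC C J
  mem-elim C J h with bex-elim _ C h
  ... | j , lt , q = j , lt , eq-elim _ _ q

  mem-intro : ∀ C J → MemC C J → memF C J ≢ 0
  mem-intro C J (j , lt , e) =
    bex-intro _ C j lt (subst (λ u → eqF u J ≢ 0) (sym e) (eq-intro J))

  mem-entry : ∀ C j {e L y} → j < C → jcodeF (lookL C j) ≡ e → jargsF (lookL C j) ≡ L →
              jvalF (lookL C j) ≡ y → MemC C (judgF e L y)
  mem-entry C j lt refl refl refl = j , lt , sym (judg-split (lookL C j))

  -- Rule for  comp f gs :  some entry  judgF F Y y  of C, where Y has the
  -- length of the code list G and its i-th element is justified by an entry
  -- judgF (G i) L (Y i) of C.
  compPremF : ℕ → ℕ → ℕ → ℕ → ℕ → ℕ → ℕ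
  compPremF C F G L y E =
    andF (eqF (jcodeF E) F) (andF (eqF (jvalF E) y) (andF (eqF (lenF (jargsF E)) (lenF G))
         (ballF (λ i → memF C (judgF (lookL G i) L (lookL (jargsF E) i))) (lenF G))))

  compRuleF : ℕ → ℕ → ℕ → ℕ → ℕ → ℕ
  compRuleF C F G L y = bexF (λ j → compPremF C F G L y (lookL C j)) C

  CompPremises : ℕ → ℕ → ℕ → ℕ → ℕ → ℕ → Set
  CompPremises C F G L y Y =
    MemC C (judgF F Y y) × lenF Y ≡ lenF G ×
    (∀ i → i < lenF G → MemC C (judgF (lookL G i) L (lookL Y i)))

  comp-elim : ∀ C F G L y → compRuleF C F G L y ≢ 0 → Σ ℕ (CompPremises C F G L y)
  comp-elim C F G L y h with bex-elim _ C h
  ... | j , lt , q = Y , memF′ , len≡ , args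
    where
      E Y : ℕ
      E = lookL C j
      Y = jargsF E
      q₂ = and-r {eqF (jcodeF E) F} q
      q₃ = and-r {eqF (jvalF E) y} q₂
      len≡ : lenF Y ≡ lenF G
      len≡ = eq-elim _ _ (and-l q₃)
      memF′ : MemC C (judgF F Y y)
      memF′ = mem-entry C j lt (eq-elim _ _ (and-l q)) refl (eq-elim _ _ (and-l q₂))
      args : ∀ i → i < lenF G → MemC C (judgF (lookL G i) L (lookL Y i))
      args i i< = mem-elim C _ (ball-elim _ (lenF G) (and-r {eqF (lenF Y) (lenF G)} q₃) i i<)

  comp-intro : ∀ C F G L y Y → CompPremises C F G L y Y → compRuleF C F G L y ≢ 0
  comp-intro C F G L y Y ((j , lt , e) , len≡ , args) =
    bex-intro _ C j lt (subst (λ E → compPremF C F G L y E ≢ 0) (sym e) prem)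
    where
      prem : compPremF C F G L y (judgF F Y y) ≢ 0
      prem rewrite jcode-judg F Y y | jargs-judg F Y y | jval-judg F Y y | len≡ =
        and-intro (eq-intro F) (and-intro (eq-intro y) (and-intro (eq-intro (lenF G))
          (ball-intro _ (lenF G) (λ i i< → mem-intro C _ (args i i<)))))

  -- Rule for  prim f g  (e is the number of  prim f g  itself):  at argument
  -- 0 ∷ X an entry for f at X;  at argument (k+1) ∷ X entries
  -- judgF e (k ∷ X) r  and  judgF G (k ∷ r ∷ X) y  for some r.
  primPremF : ℕ → ℕ → ℕ → ℕ → ℕ → ℕ → ℕ → ℕ
  primPremF C G e k X y E =
    andF (eqF (jcodeF E) e)
         (andF (eqF (jargsF E) (consF k X)) (memF C (judgF G (consF k (consF (jvalF E) X)) y)))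

  primRuleF : ℕ → ℕ → ℕ → ℕ → ℕ → ℕ → ℕ
  primRuleF C F G e L y =
    ifzF (hdF L) (memF C (judgF F (tlF L) y))
         (bexF (λ j → primPremF C G e (hdF L ∸ 1) (tlF L) y (lookL C j)) C)

  primRule-cons : ∀ C F G e k X y → primRuleF C F G e (consF k X) y ≡
    ifzF k (memF C (judgF F X y)) (bexF (λ j → primPremF C G e (k ∸ 1) X y (lookL C j)) C)
  primRule-cons C F G e k X y rewrite hd-cons k X | tl-cons k X = refl

  prim-elim-zero : ∀ C F G e X y → primRuleF C F G e (consF 0 X) y ≢ 0 → MemC C (judgF F X y)
  prim-elim-zero C F G e X y h = mem-elim C _ (subst (_≢ 0) (primRule-cons C F G e 0 X y) h)

  prim-intro-zero : ∀ C F G e X y → MemC C (judgF F X y) → primRuleF C F G e (consF 0 X) y ≢ 0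
  prim-intro-zero C F G e X y m = subst (_≢ 0) (sym (primRule-cons C F G e 0 X y)) (mem-intro C _ m)

  PrimPremises : ℕ → ℕ → ℕ → ℕ → ℕ → ℕ → ℕ → Set
  PrimPremises C G e k X y r =
    MemC C (judgF e (consF k X) r) × MemC C (judgF G (consF k (consF r X)) y)

  prim-elim-suc : ∀ C F G e k X y → primRuleF C F G e (consF (suc k) X) y ≢ 0 →
                  Σ ℕ (PrimPremises C G e k X y)
  prim-elim-suc C F G e k X y h
    with bex-elim _ C (subst (_≢ 0) (primRule-cons C F G e (suc k) X y) h)
  ... | j , lt , q = r , memPrev , mem-elim C _ (and-r {eqF (jargsF E) (consF k X)} q₂)
    where
      E r : ℕ
      E = lookL C j
      r = jvalF E
      q₂ = and-r {eqF (jcodeF E) e} q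
      memPrev : MemC C (judgF e (consF k X) r)
      memPrev = mem-entry C j lt (eq-elim _ _ (and-l q)) (eq-elim _ _ (and-l q₂)) refl

  prim-intro-suc : ∀ C F G e k X y r → PrimPremises C G e k X y r →
                   primRuleF C F G e (consF (suc k) X) y ≢ 0
  prim-intro-suc C F G e k X y r ((j , lt , ej) , memStep) =
    subst (_≢ 0) (sym (primRule-cons C F G e (suc k) X y))
      (bex-intro _ C j lt (subst (λ E → primPremF C G e k X y E ≢ 0) (sym ej) prem))
    where
      prem : primPremF C G e k X y (judgF e (consF k X) r) ≢ 0
      prem rewrite jcode-judg e (consF k X) r | jargs-judg e (consF k X) r
                 | jval-judg e (consF k X) r =
        and-intro (eq-intro e) (and-intro (eq-intro (consF k X)) (mem-intro C _ memStep))

  -- Rule for  mu f :  an entry  judgF F (y ∷ L) 0  and, for every j < y, an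
  -- entry  judgF F (j ∷ L) v  with v nonzero.
  muPremF : ℕ → ℕ → ℕ → ℕ → ℕ
  muPremF F L j E = andF (eqF (jcodeF E) F) (andF (eqF (jargsF E) (consF j L)) (nzF (jvalF E)))

  muRuleF : ℕ → ℕ → ℕ → ℕ → ℕ
  muRuleF C F L y =
    andF (memF C (judgF F (consF y L) 0))
         (ballF (λ j → bexF (λ i → muPremF F L j (lookL C i)) C) y)

  MuPremises : ℕ → ℕ → ℕ → ℕ → Set
  MuPremises C F L y =
    MemC C (judgF F (consF y L) 0) ×
    (∀ j → j < y → Σ ℕ λ v → MemC C (judgF F (consF j L) (suc v)))

  mu-elim : ∀ C F L y → muRuleF C F L y ≢ 0 → MuPremises C F L y
  mu-elim C F L y h = mem-elim C _ (and-l h) , below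
    where
      below : ∀ j → j < y → Σ ℕ λ v → MemC C (judgF F (consF j L) (suc v))
      below j j<y with bex-elim _ C (ball-elim _ y (and-r {memF C (judgF F (consF y L) 0)} h) j j<y)
      ... | i , lt , q
        with nz-elim (jvalF (lookL C i))
               (and-r {eqF (jargsF (lookL C i)) (consF j L)} (and-r {eqF (jcodeF (lookL C i)) F} q))
      ... | v , val≡ = v , mem-entry C i lt (eq-elim _ _ (and-l q))
                             (eq-elim _ _ (and-l (and-r {eqF (jcodeF (lookL C i)) F} q))) val≡

  mu-intro : ∀ C F L y → MuPremises C F L y → muRuleF C F L y ≢ 0
  mu-intro C F L y (memZero , below) = and-intro (mem-intro C _ memZero) (ball-intro _ y nonzero)
    where
      nonzero : ∀ j → j < y → bexF (λ i → muPremF F L j (lookL C i)) C ≢ 0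
      nonzero j j<y with below j j<y
      ... | v , i , lt , ei =
        bex-intro _ C i lt (subst (λ E → muPremF F L j E ≢ 0) (sym ei) prem)
        where
          prem : muPremF F L j (judgF F (consF j L) (suc v)) ≢ 0
          prem rewrite jcode-judg F (consF j L) (suc v) | jargs-judg F (consF j L) (suc v)
                     | jval-judg F (consF j L) (suc v) =
            and-intro (eq-intro F) (and-intro (eq-intro (consF j L)) (nz-suc v))

  -- Validity of a judgement relative to a certificate C and an oracle
  -- function o: the rule for the head constructor of its code is satisfied.
  module Validity (o : ℕ → ℕ) where
    validTagF : ℕ → ℕ → ℕ → ℕ → ℕ → ℕ → ℕ
    validTagF C t d e L y =
      ifzF t       (isZF y)
      (ifzF (t ∸ 1) (eqF y (suc (hdF L)))
      (ifzF (t ∸ 2) (eqF y (lookL L d))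
      (ifzF (t ∸ 3) (eqF y (o (hdF L)))
      (ifzF (t ∸ 4) (compRuleF C (fstF d) (sndF d) L y)
      (ifzF (t ∸ 5) (primRuleF C (fstF d) (sndF d) e L y)
      (ifzF (t ∸ 6) (muRuleF C d L y)
      0))))))

    validF : ℕ → ℕ → ℕ
    validF C J = validTagF C (fstF (jcodeF J)) (sndF (jcodeF J)) (jcodeF J) (jargsF J) (jvalF J)

    allValidF : ℕ → ℕ
    allValidF C = ballF (λ j → validF C (lookL C j)) C

    -- w certifies  φ_e(x) = fstF w :  its second component is a certificate
    -- whose entries are all valid and which contains that judgement
    checkF : ℕ → ℕ → ℕ → ℕ
    checkF w e x = andF (allValidF (sndF w)) (memF (sndF w) (judgF e (consF x 0) (fstF w)))

    ruleF : ∀ {n} → Code n → ℕ → ℕ → ℕ → ℕ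
    ruleF zer         C L y = isZF y
    ruleF succ        C L y = eqF y (suc (hdF L))
    ruleF (proj i)    C L y = eqF y (lookL L (toℕ i))
    ruleF orc         C L y = eqF y (o (hdF L))
    ruleF (comp f gs) C L y = compRuleF C (encC f) (encCV gs) L y
    ruleF (prim f g)  C L y = primRuleF C (encC f) (encC g) (encC (prim f g)) L y
    ruleF (mu f)      C L y = muRuleF C (encC f) L y

    valid-rule : ∀ {n} (c : Code n) C L y → validF C (judgF (encC c) L y) ≡ ruleF c C L y
    valid-rule c C L y
      rewrite jcode-judg (encC c) L y | jargs-judg (encC c) L y | jval-judg (encC c) L y = byTag c
      where
        byTag : ∀ {n} (c : Code n) →
                validTagF C (fstF (encC c)) (sndF (encC c)) (encC c) L y ≡ ruleF c C L y
        byTag zer         rewrite fst-pair 0 0 = refl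
        byTag succ        rewrite fst-pair 1 0 = refl
        byTag (proj i)    rewrite fst-pair 2 (toℕ i) | snd-pair 2 (toℕ i) = refl
        byTag orc         rewrite fst-pair 3 0 = refl
        byTag (comp f gs) rewrite fst-pair 4 (pairF (encC f) (encCV gs))
                                | snd-pair 4 (pairF (encC f) (encCV gs))
                                | fst-pair (encC f) (encCV gs) | snd-pair (encC f) (encCV gs) = refl
        byTag (prim f g)  rewrite fst-pair 5 (pairF (encC f) (encC g))
                                | snd-pair 5 (pairF (encC f) (encC g))
                                | fst-pair (encC f) (encC g) | snd-pair (encC f) (encC g) = refl
        byTag (mu f)      rewrite fst-pair 6 (encC f) | snd-pair 6 (encC f) = refl

-- Soundness and completeness of the checker (Kleene normal form), and
-- determinism of computations.
module Certificates where

  open import Data.Nat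
  open import Data.Nat.Properties
  open import Data.Product using (Σ; _×_; _,_; proj₁; proj₂)
  open import Data.Bool using (if_then_else_)
  open import Data.Fin using (Fin; toℕ; zero; suc; fromℕ<)
  open import Data.Fin.Properties using (toℕ<n; toℕ-fromℕ<)
  open import Data.Vec using (Vec; []; _∷_; lookup)
  open import Data.List using (List; []; _∷_; _++_)
  open import Data.List.Membership.Propositional using (_∈_)
  open import Data.List.Membership.Propositional.Properties
    using (∈-++⁺ˡ; ∈-++⁺ʳ; ∈-++⁻)
  open import Data.List.Relation.Unary.Any using (here; there)
  open import Data.List.Relation.Binary.Subset.Propositional using (_⊆_)
  open import Data.Sum using (inj₁; inj₂)
  open import Relation.Binary.PropositionalEquality
  open import Relation.Binary.Definitions using (tri<; tri≈; tri>)
  open import Data.Empty using (⊥-elim)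
  open Pairing
  open Truth
  open Sequences
  open Checker

  ov : Oracle → ℕ → ℕ
  ov A x = if A x then 1 else 0

  module Soundness (A : Oracle) (C : ℕ)
                   (allValid : Validity.allValidF (ov A) C ≢ 0) where
    open Validity (ov A)

    rule-holds : ∀ {n} (c : Code n) L y → MemC C (judgF (encC c) L y) → ruleF c C L y ≢ 0
    rule-holds c L y (j , lt , e) = subst (_≢ 0) (valid-rule c C L y)
      (subst (λ J → validF C J ≢ 0) e (ball-elim _ C allValid j lt))

    sound     : ∀ {n} (c : Code n) xs y → MemC C (judgF (encC c) (encV xs) y) → Eval A c xs y
    soundV    : ∀ {n m} (gs : Vec (Code n) m) xs ys →
                (∀ i → MemC C (judgF (encC (lookup gs i)) (encV xs) (lookup ys i))) →
                EvalV A gs xs ys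
    soundPrim : ∀ {n} (f : Code n) g k xs y →
                MemC C (judgF (encC (prim f g)) (encV (k ∷ xs)) y) →
                Eval A (prim f g) (k ∷ xs) y

    sound {n} zer xs y m with isZ-elim y (rule-holds (zer {n}) (encV xs) y m)
    ... | refl = zerE
    sound succ (x ∷ []) y m
      with trans (eq-elim _ _ (rule-holds succ (encV (x ∷ [])) y m)) (cong suc (hd-cons x 0))
    ... | refl = succE
    sound (proj i) xs y m
      with trans (eq-elim _ _ (rule-holds (proj i) (encV xs) y m)) (look-encV xs i)
    ... | refl = projE i
    sound orc (x ∷ []) y m
      with trans (eq-elim _ _ (rule-holds orc (encV (x ∷ [])) y m)) (cong (ov A) (hd-cons x 0))
    ... | refl = orcE
    sound (comp f gs) xs y m
      with comp-elim C (encC f) (encCV gs) (encV xs) y (rule-holds (comp f gs) (encV xs) y m)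
    ... | Y , memf , len≡ , args with len-inv Y (trans len≡ (len-encCV gs))
    ... | ys , refl = compE (soundV gs xs ys argsAt) (sound f ys y memf)
      where
        argsAt : ∀ i → MemC C (judgF (encC (lookup gs i)) (encV xs) (lookup ys i))
        argsAt i = subst (MemC C)
          (cong₂ (λ a b → judgF a (encV xs) b) (look-encCV gs i) (look-encV ys i))
          (args (toℕ i) (subst (toℕ i <_) (sym (len-encCV gs)) (toℕ<n i)))
    sound (prim f g) (k ∷ xs) y m = soundPrim f g k xs y m
    sound (mu f) xs y m with mu-elim C (encC f) (encV xs) y (rule-holds (mu f) (encV xs) y m)
    ... | memZero , below =
      muE (sound f (y ∷ xs) 0 memZero)
          (λ j j<y → proj₁ (below j j<y) , sound f (j ∷ xs) _ (proj₂ (below j j<y)))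

    soundV []       xs []       h = []E
    soundV (g ∷ gs) xs (y ∷ ys) h =
      sound g xs y (h zero) ∷E soundV gs xs ys (λ i → h (suc i))

    soundPrim f g zero xs y m = primZ (sound f xs y
      (prim-elim-zero C _ _ _ (encV xs) y (rule-holds (prim f g) (encV (0 ∷ xs)) y m)))
    soundPrim f g (suc k) xs y m
      with prim-elim-suc C _ _ _ k (encV xs) y (rule-holds (prim f g) (encV (suc k ∷ xs)) y m)
    ... | r , memPrev , memStep =
      primS (soundPrim f g k xs r memPrev) (sound g (k ∷ r ∷ xs) y memStep)

  -- A list of
  -- judgements is closed when each entry is valid relative to every list
  -- containing it; closed lists are built along the derivation of Eval.
  module Completeness (A : Oracle) where
    open Validity (ov A)

    Closed : List ℕ → Set
    Closed l = ∀ {l′} → l ⊆ l′ → ∀ {J} → J ∈ l → validF (encL l′) J ≢ 0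

    at-index : ∀ {m} (P : ℕ → Set) → (∀ (i : Fin m) → P (toℕ i)) → ∀ i → i < m → P i
    at-index P h i i<m = subst P (toℕ-fromℕ< i<m) (h (fromℕ< i<m))

    closed-[] : Closed []
    closed-[] sub ()

    closed-++ : ∀ l₁ l₂ → Closed l₁ → Closed l₂ → Closed (l₁ ++ l₂)
    closed-++ l₁ l₂ c₁ c₂ sub m with ∈-++⁻ l₁ m
    ... | inj₁ m₁ = c₁ (λ x → sub (∈-++⁺ˡ x)) m₁
    ... | inj₂ m₂ = c₂ (λ x → sub (∈-++⁺ʳ l₁ x)) m₂

    member : ∀ {J l l′} → J ∈ l → l ⊆ l′ → MemC (encL l′) J
    member m sub = mem-encL (sub m)

    Derivable : ℕ → Set
    Derivable J = Σ (List ℕ) λ l → J ∈ l × Closed l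

    by-rule : ∀ {n} (c : Code n) L y l → Closed l →
              (∀ {l′} → judgF (encC c) L y ∷ l ⊆ l′ → ruleF c (encL l′) L y ≢ 0) →
              Derivable (judgF (encC c) L y)
    by-rule c L y l closed rule = _ ∷ l , here refl , closed′
      where
        closed′ : Closed (judgF (encC c) L y ∷ l)
        closed′ sub (here refl) = subst (_≢ 0) (sym (valid-rule c _ L y)) (rule sub)
        closed′ sub (there m)   = closed (λ x → sub (there x)) m

    DerivableAll : ∀ {n m} → Vec (Code n) m → Vec ℕ n → Vec ℕ m → Set
    DerivableAll gs xs ys = Σ (List ℕ) λ l →
      (∀ i → judgF (encC (lookup gs i)) (encV xs) (lookup ys i) ∈ l) × Closed l

    DerivableBelow : ∀ {n} → Code (suc n) → Vec ℕ n → ℕ → Set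
    DerivableBelow f xs k = Σ (List ℕ) λ l →
      Closed l × (∀ j → j < k → Σ ℕ λ v → judgF (encC f) (encV (j ∷ xs)) (suc v) ∈ l)

    derivable-∷ : ∀ {n m} {g : Code n} {gs : Vec (Code n) m} {xs y ys} →
                  Derivable (judgF (encC g) (encV xs) y) → DerivableAll gs xs ys →
                  DerivableAll (g ∷ gs) xs (y ∷ ys)
    derivable-∷ (l₁ , m₁ , c₁) (l₂ , m₂ , c₂) =
      l₁ ++ l₂ , (λ { zero → ∈-++⁺ˡ m₁ ; (suc i) → ∈-++⁺ʳ l₁ (m₂ i) }) , closed-++ l₁ l₂ c₁ c₂

    derivable-below : ∀ {n} (f : Code (suc n)) xs k →
                      (∀ j → j < k → Σ ℕ λ v → Derivable (judgF (encC f) (encV (j ∷ xs)) (suc v))) →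
                      DerivableBelow f xs k
    derivable-below f xs zero    below = [] , closed-[] , λ j ()
    derivable-below f xs (suc k) below
      with derivable-below f xs k (λ j j<k → below j (m<n⇒m<1+n j<k)) | below k ≤-refl
    ... | l₁ , c₁ , m₁ | v , l₂ , m₂ , c₂ = l₁ ++ l₂ , closed-++ l₁ l₂ c₁ c₂ , mem
      where
        mem : ∀ j → j < suc k → Σ ℕ λ v → judgF (encC f) (encV (j ∷ xs)) (suc v) ∈ l₁ ++ l₂
        mem j (s≤s j≤k) with m≤n⇒m<n∨m≡n j≤k
        ... | inj₁ j<k  = proj₁ (m₁ j j<k) , ∈-++⁺ˡ (proj₂ (m₁ j j<k))
        ... | inj₂ refl = v , ∈-++⁺ʳ l₁ m₂

    derive-comp : ∀ {n m} (f : Code m) (gs : Vec (Code n) m) xs ys y →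
                  Derivable (judgF (encC f) (encV ys) y) → DerivableAll gs xs ys →
                  Derivable (judgF (encC (comp f gs)) (encV xs) y)
    derive-comp {m = m} f gs xs ys y (lf , mf , cf) (lg , mg , cg) =
      by-rule (comp f gs) (encV xs) y (lf ++ lg) (closed-++ lf lg cf cg) λ sub →
        comp-intro _ (encC f) (encCV gs) (encV xs) y (encV ys)
          ( member mf (λ x → sub (there (∈-++⁺ˡ x)))
          , trans (len-encV ys) (sym (len-encCV gs))
          , λ i i< → at-index (Arg _) (arg sub) i (subst (i <_) (len-encCV gs) i<))
      where
        Arg : List ℕ → ℕ → Set
        Arg l′ i = MemC (encL l′) (judgF (lookL (encCV gs) i) (encV xs) (lookL (encV ys) i))
        arg : ∀ {l′} → judgF (encC (comp f gs)) (encV xs) y ∷ lf ++ lg ⊆ l′ →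
              (i : Fin m) → Arg l′ (toℕ i)
        arg sub i rewrite look-encCV gs i | look-encV ys i =
          member (mg i) (λ x → sub (there (∈-++⁺ʳ lf x)))

    derive-primZ : ∀ {n} (f : Code n) g (xs : Vec ℕ n) y →
                   Derivable (judgF (encC f) (encV xs) y) →
                   Derivable (judgF (encC (prim f g)) (encV (0 ∷ xs)) y)
    derive-primZ f g xs y (lf , mf , cf) = by-rule (prim f g) (encV (0 ∷ xs)) y lf cf λ sub →
      prim-intro-zero _ (encC f) (encC g) _ (encV xs) y (member mf (λ x → sub (there x)))

    derive-primS : ∀ {n} (f : Code n) g k (xs : Vec ℕ n) r y →
                   Derivable (judgF (encC (prim f g)) (encV (k ∷ xs)) r) →
                   Derivable (judgF (encC g) (encV (k ∷ r ∷ xs)) y) →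
                   Derivable (judgF (encC (prim f g)) (encV (suc k ∷ xs)) y)
    derive-primS f g k xs r y (l₁ , m₁ , c₁) (l₂ , m₂ , c₂) =
      by-rule (prim f g) (encV (suc k ∷ xs)) y (l₁ ++ l₂) (closed-++ l₁ l₂ c₁ c₂) λ sub →
        prim-intro-suc _ (encC f) (encC g) _ k (encV xs) y r
          ( member m₁ (λ x → sub (there (∈-++⁺ˡ x)))
          , member m₂ (λ x → sub (there (∈-++⁺ʳ l₁ x))))

    derive-mu : ∀ {n} (f : Code (suc n)) xs k →
                Derivable (judgF (encC f) (encV (k ∷ xs)) 0) → DerivableBelow f xs k →
                Derivable (judgF (encC (mu f)) (encV xs) k)
    derive-mu f xs k (l₀ , m₀ , c₀) (lb , cb , mb) =
      by-rule (mu f) (encV xs) k (l₀ ++ lb) (closed-++ l₀ lb c₀ cb) λ sub →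
        mu-intro _ (encC f) (encV xs) k
          ( member m₀ (λ x → sub (there (∈-++⁺ˡ x)))
          , λ j j<k → proj₁ (mb j j<k)
                    , member (proj₂ (mb j j<k)) (λ x → sub (there (∈-++⁺ʳ l₀ x))))

    complete  : ∀ {n} {c : Code n} {xs y} → Eval A c xs y →
                Derivable (judgF (encC c) (encV xs) y)
    completeV : ∀ {n m} {gs : Vec (Code n) m} {xs ys} → EvalV A gs xs ys → DerivableAll gs xs ys

    complete {n} {xs = xs} zerE = by-rule (zer {n}) (encV xs) 0 [] closed-[] (λ _ → isZ-intro)
    complete (succE {x}) = by-rule succ (encV (x ∷ [])) (suc x) [] closed-[]
      (λ _ → subst (λ u → eqF (suc x) (suc u) ≢ 0) (sym (hd-cons x 0)) (eq-intro (suc x)))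
    complete (projE {xs = xs} i) = by-rule (proj i) (encV xs) (lookup xs i) [] closed-[]
      (λ _ → subst (λ u → eqF (lookup xs i) u ≢ 0) (sym (look-encV xs i)) (eq-intro (lookup xs i)))
    complete (orcE {x}) = by-rule orc (encV (x ∷ [])) (ov A x) [] closed-[]
      (λ _ → subst (λ u → eqF (ov A x) (ov A u) ≢ 0) (sym (hd-cons x 0)) (eq-intro (ov A x)))
    complete (compE {f = f} {gs} {xs} {ys} {y} evs ev) =
      derive-comp f gs xs ys y (complete ev) (completeV evs)
    complete (primZ {f = f} {g} {xs} {y} ev) = derive-primZ f g xs y (complete ev)
    complete (primS {f = f} {g} {xs} {k} {r} {y} evPrev evStep) =
      derive-primS f g k xs r y (complete evPrev) (complete evStep)
    complete (muE {f = f} {xs} {k} evZero below) =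
      derive-mu f xs k (complete evZero) (derivable-below f xs k derivBelow)
      where
        derivBelow : ∀ j → j < k → Σ ℕ λ v → Derivable (judgF (encC f) (encV (j ∷ xs)) (suc v))
        derivBelow j j<k with below j j<k
        ... | v , ev = v , complete ev

    completeV []E         = [] , (λ ()) , closed-[]
    completeV (ev ∷E evs) = derivable-∷ (complete ev) (completeV evs)

  module NormalForm (A : Oracle) where
    open Validity (ov A)
    open Completeness A using (Closed; complete)

    -- the number 0, read as a judgement, claims that the code zer yields 0
    valid-zero : ∀ C → validF C 0 ≢ 0
    valid-zero C rewrite fst0 | snd0 | fst0 | snd0 = isZ-intro

    allValid-closed : ∀ l → Closed l → allValidF (encL l) ≢ 0
    allValid-closed l closed = ball-intro _ (encL l) λ j _ → entry j
      where
        entry : ∀ j → validF (encL l) (lookL (encL l) j) ≢ 0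
        entry j with look-encL l j
        ... | inj₁ e = subst (λ J → validF (encL l) J ≢ 0) (sym e) (valid-zero (encL l))
        ... | inj₂ m = closed (λ x → x) m

    certificate-exists : ∀ (c : Code 1) x y → Eval A c (x ∷ []) y →
                         Σ ℕ λ w → checkF w (encC c) x ≢ 0 × fstF w ≡ y
    certificate-exists c x y ev with complete ev
    ... | l , m , closed = pairF y (encL l) , check , fst-pair y (encL l)
      where
        check : checkF (pairF y (encL l)) (encC c) x ≢ 0
        check rewrite fst-pair y (encL l) | snd-pair y (encL l) =
          and-intro (allValid-closed l closed) (mem-intro (encL l) _ (mem-encL m))

    certificate-sound : ∀ (c : Code 1) x w → checkF w (encC c) x ≢ 0 → Eval A c (x ∷ []) (fstF w)
    certificate-sound c x w h = Soundness.sound A (sndF w) (and-l h) c (x ∷ []) (fstF w)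
      (mem-elim (sndF w) _ (and-r {allValidF (sndF w)} h))

  module _ (A : Oracle) where
    eval-deterministic  : ∀ {n} {c : Code n} {xs y y′} → Eval A c xs y → Eval A c xs y′ → y ≡ y′
    evalV-deterministic : ∀ {n m} {gs : Vec (Code n) m} {xs ys ys′} →
                          EvalV A gs xs ys → EvalV A gs xs ys′ → ys ≡ ys′
    eval-deterministic zerE        zerE         = refl
    eval-deterministic succE       succE        = refl
    eval-deterministic (projE i)   (projE .i)   = refl
    eval-deterministic orcE        orcE         = refl
    eval-deterministic (compE evs ev) (compE evs′ ev′) with evalV-deterministic evs evs′
    ... | refl = eval-deterministic ev ev′
    eval-deterministic (primZ ev)  (primZ ev′)  = eval-deterministic ev ev′
    eval-deterministic (primS ev₁ ev₂) (primS ev₁′ ev₂′) with eval-deterministic ev₁ ev₁′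
    ... | refl = eval-deterministic ev₂ ev₂′
    eval-deterministic (muE {k = k} ev below) (muE {k = k′} ev′ below′) with <-cmp k k′
    ... | tri≈ _ e _ = e
    ... | tri< k<k′ _ _ = ⊥-elim (0≢1+n (eval-deterministic ev (proj₂ (below′ k k<k′))))
    ... | tri> _ _ k′<k = ⊥-elim (0≢1+n (eval-deterministic ev′ (proj₂ (below k′ k′<k))))
    evalV-deterministic []E         []E           = refl
    evalV-deterministic (ev ∷E evs) (ev′ ∷E evs′)
      with eval-deterministic ev ev′ | evalV-deterministic evs evs′
    ... | refl | refl = refl

-- Expressions for the checker, and the checker as a code.
module Programs where

  open import Data.Nat
  open import Data.Fin using (zero; suc)
  open import Data.Vec using (Vec; []; _∷_; tabulate)
  open import Relation.Binary.PropositionalEquality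
  open Expressions
  open Pairing
  open Truth
  open Sequences
  open Checker

  -- Expressions for the functions of the previous sections; each name xE
  -- denotes the function xF.  Variables are de Bruijn indices v0, v1, ….
  f1 : ∀ {n} → Expr 1 → Expr n → Expr n
  f1 g a = app g (a ∷ [])

  f2 : ∀ {n} → Expr 2 → Expr n → Expr n → Expr n
  f2 g a b = app g (a ∷ b ∷ [])

  v0 : ∀ {n} → Expr (suc n)
  v0 = var zero
  v1 : ∀ {n} → Expr (suc (suc n))
  v1 = var (suc zero)
  v2 : ∀ {n} → Expr (suc (suc (suc n)))
  v2 = var (suc (suc zero))
  v3 : ∀ {n} → Expr (suc (suc (suc (suc n))))
  v3 = var (suc (suc (suc zero)))
  v4 : ∀ {n} → Expr (suc (suc (suc (suc (suc n)))))
  v4 = var (suc (suc (suc (suc zero))))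
  v5 : ∀ {n} → Expr (suc (suc (suc (suc (suc (suc n))))))
  v5 = var (suc (suc (suc (suc (suc zero)))))
  v6 : ∀ {n} → Expr (suc (suc (suc (suc (suc (suc (suc n)))))))
  v6 = var (suc (suc (suc (suc (suc (suc zero))))))

  -- inside the step of a recursion over (i, r), the outer variables
  outer : ∀ {n} → Vec (Expr (suc (suc n))) n
  outer = tabulate (λ j → var (suc (suc j)))

  -- bounded quantifiers and search over the predicate P (its variable 0)
  bexE : ∀ {n} → Expr (suc n) → Expr n → Expr n
  bexE P B = rec (lit 0) (ifz (app P (v0 ∷ outer)) v1 (lit 1)) B

  ballE : ∀ {n} → Expr (suc n) → Expr n → Expr n
  ballE P B = rec (lit 1) (ifz (app P (v0 ∷ outer)) (lit 0) v1) B

  bminE : ∀ {n} → Expr (suc n) → Expr n → Expr n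
  bminE P B = rec (lit 0) (ifz (sub v0 v1) (ifz (app P (v0 ∷ outer)) (add (lit 1) v0) v0) v1) B

  eqE : Expr 2
  eqE = ifz (add (sub v0 v1) (sub v1 v0)) (lit 1) (lit 0)

  eq : ∀ {n} → Expr n → Expr n → Expr n
  eq = f2 eqE

  isZE nzE : ∀ {n} → Expr n → Expr n
  isZE a = ifz a (lit 1) (lit 0)
  nzE  a = ifz a (lit 0) (lit 1)

  andE : ∀ {n} → Expr n → Expr n → Expr n
  andE = mul

  leE : ∀ {n} → Expr n → Expr n → Expr n
  leE a b = isZE (sub a b)

  triE : Expr 1
  triE = rec (lit 0) (add v1 (add (lit 1) v0)) v0

  pairE : Expr 2
  pairE = add (f1 triE (add v0 v1)) v1

  diagE : Expr 1
  diagE = rec (lit 0) (ifz (sub (f1 triE (add (lit 1) v1)) (add (lit 1) v0)) (add (lit 1) v1) v1) v0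

  sndE : Expr 1
  sndE = sub v0 (f1 triE (f1 diagE v0))

  fstE : Expr 1
  fstE = sub (f1 diagE v0) (f1 sndE v0)

  consE : Expr 2
  consE = add (lit 1) (f2 pairE v0 v1)

  hdE tlE : Expr 1
  hdE = f1 fstE (sub v0 (lit 1))
  tlE = f1 sndE (sub v0 (lit 1))

  tlIE : Expr 2
  tlIE = rec v1 (f1 tlE v1) v0

  lookE : Expr 2
  lookE = f1 hdE (f2 tlIE v1 v0)

  lenE : Expr 1
  lenE = bminE (isZE (f2 tlIE v0 v1)) (add (lit 1) v0)

  memE : Expr 2
  memE = bexE (eq (f2 lookE v1 v0) v2) v0

  judgE : Expr 3
  judgE = f2 pairE v0 (f2 pairE v1 v2)

  jcodeE jargsE jvalE : Expr 1
  jcodeE = f1 fstE v0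
  jargsE = f1 fstE (f1 sndE v0)
  jvalE  = f1 sndE (f1 sndE v0)

  compPremE : Expr 6
  compPremE =
    andE (eq (f1 jcodeE v5) v1) (andE (eq (f1 jvalE v5) v4) (andE (eq (f1 lenE (f1 jargsE v5)) (f1 lenE v2))
         (ballE (f2 memE v1 (app judgE (f2 lookE v3 v0 ∷ v4 ∷ f2 lookE (f1 jargsE v6) v0 ∷ [])))
                (f1 lenE v2))))

  compRuleE : Expr 5
  compRuleE = bexE (app compPremE (v1 ∷ v2 ∷ v3 ∷ v4 ∷ v5 ∷ f2 lookE v1 v0 ∷ [])) v0

  primPremE : Expr 7
  primPremE = andE (eq (f1 jcodeE v6) v2) (andE (eq (f1 jargsE v6) (f2 consE v3 v4))
    (f2 memE v0 (app judgE (v1 ∷ f2 consE v3 (f2 consE (f1 jvalE v6) v4) ∷ v5 ∷ []))))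

  primRuleE : Expr 6
  primRuleE = ifz (f1 hdE v4) (f2 memE v0 (app judgE (v1 ∷ f1 tlE v4 ∷ v5 ∷ [])))
    (bexE (app primPremE (v1 ∷ v3 ∷ v4 ∷ sub (f1 hdE v5) (lit 1) ∷ f1 tlE v5 ∷ v6 ∷ f2 lookE v1 v0 ∷ []))
          v0)

  muPremE : Expr 4
  muPremE =
    andE (eq (f1 jcodeE v3) v0) (andE (eq (f1 jargsE v3) (f2 consE v2 v1)) (nzE (f1 jvalE v3)))

  muRuleE : Expr 4
  muRuleE = andE (f2 memE v0 (app judgE (v1 ∷ f2 consE v3 v2 ∷ lit 0 ∷ [])))
    (ballE (bexE (app muPremE (v3 ∷ v4 ∷ v1 ∷ f2 lookE v2 v0 ∷ [])) v1) v3)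

  validTagE : Expr 6
  validTagE =
    ifz v1 (isZE v5)
    (ifz (sub v1 (lit 1)) (eq v5 (add (lit 1) (f1 hdE v4)))
    (ifz (sub v1 (lit 2)) (eq v5 (f2 lookE v4 v2))
    (ifz (sub v1 (lit 3)) (eq v5 (orac (f1 hdE v4)))
    (ifz (sub v1 (lit 4)) (app compRuleE (v0 ∷ f1 fstE v2 ∷ f1 sndE v2 ∷ v4 ∷ v5 ∷ []))
    (ifz (sub v1 (lit 5)) (app primRuleE (v0 ∷ f1 fstE v2 ∷ f1 sndE v2 ∷ v3 ∷ v4 ∷ v5 ∷ []))
    (ifz (sub v1 (lit 6)) (app muRuleE (v0 ∷ v2 ∷ v4 ∷ v5 ∷ []))
    (lit 0)))))))

  validE : Expr 2
  validE = app validTagE (v0 ∷ f1 fstE (f1 jcodeE v1) ∷ f1 sndE (f1 jcodeE v1) ∷ f1 jcodeE v1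
                              ∷ f1 jargsE v1 ∷ f1 jvalE v1 ∷ [])

  allValidE : Expr 1
  allValidE = ballE (f2 validE v1 (f2 lookE v1 v0)) v0

  checkE : Expr 3
  checkE = andE (f1 allValidE (f1 sndE v0))
                (f2 memE (f1 sndE v0) (app judgE (v1 ∷ f2 consE v2 (lit 0) ∷ f1 fstE v0 ∷ [])))

  -- checkE denotes the checker; this is verified by evaluation, which needs
  -- the definitions of pairing, truth values, search and sequence codes
  opaque
    unfolding triF andF bminF hdF
    checkE-meaning : ∀ o w e x →
                     Semantics.sem o (λ _ _ _ → 0) checkE (w ∷ e ∷ x ∷ []) ≡ Validity.checkF o w e x
    checkE-meaning o w e x = refl

  -- The checker as a code, given a code O for the oracle function; and
  -- programs which may call the checker ('call a b c' runs checkF a b c).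
  checkerC : Code 1 → Code 3
  checkerC O = Compile.compile O zer checkE

  program : ∀ {n} → Code 1 → Expr n → Code n
  program O e = Compile.compile O (checkerC O) e

  module _ (A : Oracle) (O : Code 1) (o : ℕ → ℕ)
           (O-ev : ∀ x → Eval A O (x ∷ []) (o x)) where
    open Validity o using (checkF)

    checkerEv : ∀ w e x → Eval A (checkerC O) (w ∷ e ∷ x ∷ []) (checkF w e x)
    checkerEv w e x = subst (Eval A (checkerC O) (w ∷ e ∷ x ∷ [])) (checkE-meaning o w e x)
      (CompileCorrect.compileEv A O o O-ev zer (λ _ _ _ → 0) (λ _ _ _ → zerE)
                                checkE (w ∷ e ∷ x ∷ []))

    programEv : ∀ {n} (e : Expr n) xs → Eval A (program O e) xs (Semantics.sem o checkF e xs)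
    programEv = CompileCorrect.compileEv A O o O-ev (checkerC O) checkF checkerEv

-- Sums, canonical indices of finite sets, and counting listed values.
module Counting where

  open import Data.Nat
  open import Data.Nat.Properties
  open import Data.Nat.DivMod
  open import Data.Sum using (inj₁; inj₂)
  open import Relation.Nullary using (yes; no)
  open import Relation.Binary.PropositionalEquality
  open Expressions using (recF)
  open Truth

  sumF : (ℕ → ℕ) → ℕ → ℕ
  sumF p B = recF 0 (λ k r → r + p k) B

  pow2F : ℕ → ℕ
  pow2F y = recF 1 (λ _ r → r + r) y

  sum-cong : ∀ (p q : ℕ → ℕ) B → (∀ y → p y ≡ q y) → sumF p B ≡ sumF q B
  sum-cong p q zero    h = refl
  sum-cong p q (suc B) h = cong₂ _+_ (sum-cong p q B h) (h B)

  sum-mono : ∀ (p q : ℕ → ℕ) B → (∀ y → p y ≤ q y) → sumF p B ≤ sumF q B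
  sum-mono p q zero    h = z≤n
  sum-mono p q (suc B) h = +-mono-≤ (sum-mono p q B h) (h B)

  sum-+ : ∀ (p q : ℕ → ℕ) B → sumF (λ y → p y + q y) B ≡ sumF p B + sumF q B
  sum-+ p q zero    = refl
  sum-+ p q (suc B) = begin
    sumF (λ y → p y + q y) B + (p B + q B)  ≡⟨ cong (_+ (p B + q B)) (sum-+ p q B) ⟩
    (sumF p B + sumF q B) + (p B + q B)     ≡⟨ +-assoc (sumF p B) (sumF q B) (p B + q B) ⟩
    sumF p B + (sumF q B + (p B + q B))     ≡⟨ cong (sumF p B +_) (+-assoc (sumF q B) (p B) (q B)) ⟨
    sumF p B + ((sumF q B + p B) + q B)     ≡⟨ cong (λ u → sumF p B + (u + q B)) (+-comm (sumF q B) (p B)) ⟩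
    sumF p B + ((p B + sumF q B) + q B)     ≡⟨ cong (sumF p B +_) (+-assoc (p B) (sumF q B) (q B)) ⟩
    sumF p B + (p B + (sumF q B + q B))     ≡⟨ +-assoc (sumF p B) (p B) (sumF q B + q B) ⟨
    (sumF p B + p B) + (sumF q B + q B)     ∎
    where open ≡-Reasoning

  sum-zero : ∀ B → sumF (λ _ → 0) B ≡ 0
  sum-zero zero    = refl
  sum-zero (suc B) = trans (+-identityʳ (sumF (λ _ → 0) B)) (sum-zero B)

  sum-head : ∀ (p : ℕ → ℕ) B → sumF p (suc B) ≡ p 0 + sumF (λ y → p (suc y)) B
  sum-head p zero    = +-comm 0 (p 0)
  sum-head p (suc B) = trans (cong (_+ p (suc B)) (sum-head p B)) (+-assoc (p 0) _ (p (suc B)))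

  sum-double : ∀ (q : ℕ → ℕ) B → sumF (λ y → 2 * q y) B ≡ 2 * sumF q B
  sum-double q zero    = refl
  sum-double q (suc B) =
    trans (cong (_+ 2 * q B) (sum-double q B)) (sym (*-distribˡ-+ 2 (sumF q B) (q B)))

  summand≤sum : ∀ (p : ℕ → ℕ) B i → i < B → p i ≤ sumF p B
  summand≤sum p (suc B) i (s≤s i≤B) with m≤n⇒m<n∨m≡n i≤B
  ... | inj₁ i<B  = ≤-trans (summand≤sum p B i i<B) (m≤m+n (sumF p B) (p B))
  ... | inj₂ refl = m≤n+m (p i) (sumF p B)

  setIndexF : (ℕ → ℕ) → ℕ → ℕ
  setIndexF b B = sumF (λ y → pow2F y * b y) B

  setIndex-head : ∀ (b : ℕ → ℕ) B →
                  setIndexF b (suc B) ≡ b 0 + 2 * setIndexF (λ y → b (suc y)) B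
  setIndex-head b B = begin
    setIndexF b (suc B)
      ≡⟨ sum-head _ B ⟩
    1 * b 0 + sumF (λ y → (pow2F y + pow2F y) * b (suc y)) B
      ≡⟨ cong₂ _+_ (*-identityˡ (b 0)) (sum-cong _ _ B double) ⟩
    b 0 + sumF (λ y → 2 * (pow2F y * b (suc y))) B
      ≡⟨ cong (b 0 +_) (sum-double _ B) ⟩
    b 0 + 2 * setIndexF (λ y → b (suc y)) B
      ∎
    where
      open ≡-Reasoning
      double : ∀ y → (pow2F y + pow2F y) * b (suc y) ≡ 2 * (pow2F y * b (suc y))
      double y = trans (*-distribʳ-+ (b (suc y)) (pow2F y) (pow2F y))
                       (cong (pow2F y * b (suc y) +_) (sym (+-identityʳ (pow2F y * b (suc y)))))

  digit-mod : ∀ a R → a ≤ 1 → (a + 2 * R) % 2 ≡ a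
  digit-mod zero          R h rewrite *-comm 2 R = m*n%n≡0 R 2
  digit-mod (suc zero)    R h rewrite *-comm 2 R = [m+kn]%n≡m%n 1 R 2
  digit-mod (suc (suc a)) R (s≤s ())

  digit-div : ∀ a R → a ≤ 1 → (a + 2 * R) / 2 ≡ R
  digit-div zero          R h rewrite *-comm 2 R = m*n/n≡m R 2
  digit-div (suc zero)    R h rewrite *-comm 2 R =
    trans (+-distrib-/ 1 (R * 2) (subst (λ u → 1 % 2 + u < 2) (sym (m*n%n≡0 R 2)) ≤-refl))
          (m*n/n≡m R 2)
  digit-div (suc (suc a)) R (s≤s ())

  bit-setIndex : ∀ y B (b : ℕ → ℕ) → (∀ x → b x ≤ 1) → y < B →
                 bit y (setIndexF b B) ≡ b y
  bit-setIndex zero    (suc B) b digit lt rewrite setIndex-head b B =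
    digit-mod (b 0) (setIndexF (λ y → b (suc y)) B) (digit 0)
  bit-setIndex (suc y) (suc B) b digit (s≤s lt) rewrite setIndex-head b B
    | digit-div (b 0) (setIndexF (λ y → b (suc y)) B) (digit 0) =
    bit-setIndex y B (λ y → b (suc y)) (λ y → digit (suc y)) lt

  popcount-setIndex : ∀ fuel B (b : ℕ → ℕ) → (∀ y → b y ≤ 1) →
                      popcount′ fuel (setIndexF b B) ≤ sumF b B
  popcount-setIndex zero       B       b digit = z≤n
  popcount-setIndex (suc fuel) zero    b digit = ≤-reflexive (popcount-zero fuel)
    where
      popcount-zero : ∀ f → popcount′ f 0 ≡ 0
      popcount-zero zero    = refl
      popcount-zero (suc f) = popcount-zero f
  popcount-setIndex (suc fuel) (suc B) b digit
    rewrite setIndex-head b B | digit-mod (b 0) (setIndexF (λ y → b (suc y)) B) (digit 0)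
          | digit-div (b 0) (setIndexF (λ y → b (suc y)) B) (digit 0) | sum-head b B =
    +-monoʳ-≤ (b 0) (popcount-setIndex fuel B (λ y → b (suc y)) (λ y → digit (suc y)))

  member< : ∀ m k → m ∈D k → m < k
  member< zero    zero    ()
  member< zero    (suc k) e = s≤s z≤n
  member< (suc m) k       e = begin-strict
    suc m        <⟨ s≤s (s≤s (m≤m*n m 2)) ⟩
    suc m * 2    ≤⟨ *-monoˡ-≤ 2 (member< m (k / 2) e) ⟩
    k / 2 * 2    ≤⟨ m/n*n≤m k 2 ⟩
    k            ∎
    where open ≤-Reasoning

  listedF : (ℕ → ℕ) → (ℕ → ℕ) → ℕ → ℕ → ℕ
  listedF L g n y = bexF (λ e → andF (L e) (eqF (g e) y)) n

  sum-eq-zero : ∀ x B → B ≤ x → sumF (eqF x) B ≡ 0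
  sum-eq-zero x zero    h = refl
  sum-eq-zero x (suc B) h
    rewrite sum-eq-zero x B (≤-trans (n≤1+n B) h)
          | eq-distinct x B (λ e → <-irrefl (sym e) h) = refl

  sum-eq≤1 : ∀ x B → sumF (eqF x) B ≤ 1
  sum-eq≤1 x zero = z≤n
  sum-eq≤1 x (suc B) with x ≟ B
  ... | yes refl rewrite sum-eq-zero x x ≤-refl | eq-refl x = ≤-refl
  ... | no x≢B rewrite eq-distinct x B x≢B | +-identityʳ (sumF (eqF x) B) = sum-eq≤1 x B

  listed-suc : ∀ L g n y → listedF L g (suc n) y ≤ listedF L g n y + eqF (g n) y
  listed-suc L g n y rewrite bex-suc (λ e → andF (L e) (eqF (g e) y)) n
    with andF (L n) (eqF (g n) y) in e
  ... | zero  = m≤m+n _ _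
  ... | suc _ rewrite eq-elim (g n) y (and-r {L n} (λ z → 0≢1+n (trans (sym z) e))) | eq-refl y =
    m≤n+m 1 _

  listed-count : ∀ L g n B → sumF (listedF L g n) B ≤ n
  listed-count L g zero    B =
    ≤-reflexive (trans (sum-cong _ _ B (λ y → bex-zero _)) (sum-zero B))
  listed-count L g (suc n) B = begin
    sumF (listedF L g (suc n)) B                      ≤⟨ sum-mono _ _ B (listed-suc L g n) ⟩
    sumF (λ y → listedF L g n y + eqF (g n) y) B      ≡⟨ sum-+ (listedF L g n) (eqF (g n)) B ⟩
    sumF (listedF L g n) B + sumF (eqF (g n)) B
                                                      ≤⟨ +-mono-≤ (listed-count L g n B) (sum-eq≤1 (g n) B) ⟩
    n + 1                                             ≡⟨ +-comm n 1 ⟩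
    suc n                                             ∎
    where open ≤-Reasoning

-- The trace at argument n for a bound d, as a function and as an expression.
module TraceConstruction where

  open import Data.Nat
  open import Data.Vec using ([]; _∷_)
  open import Relation.Binary.PropositionalEquality
  open Expressions
  open Pairing
  open Truth
  open Checker
  open Certificates using (ov)
  open Programs
  open Counting

  open Validity (ov ∅) renaming (checkF to check∅F)

  -- For e < n let leastCertF n d e be
  -- the least certificate w ≤ d of a computation  φ_e(n) = fstF w  (without
  -- oracle), if there is one.  The trace lists the values of these
  -- computations: at most n numbers, each at most d.
  leastCertF : ℕ → ℕ → ℕ → ℕ
  leastCertF n d e = bminF (λ w → check∅F w e n) (suc d)

  listedAtF : ℕ → ℕ → ℕ → ℕ
  listedAtF n d = listedF (λ e → leF (leastCertF n d e) d) (λ e → fstF (leastCertF n d e)) n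

  traceIndexF : ℕ → ℕ → ℕ
  traceIndexF n d = setIndexF (listedAtF n d) (suc d)

  sumE : ∀ {n} → Expr (suc n) → Expr n → Expr n
  sumE P B = rec (lit 0) (add v1 (app P (v0 ∷ outer))) B

  pow2E : Expr 1
  pow2E = rec (lit 1) (add v1 v1) v0

  leastCertE : Expr 3
  leastCertE = bminE (call v0 v1 v2) (add (lit 1) v2)

  listedAtE : Expr 3
  listedAtE = bexE (andE (leE (app leastCertE (v0 ∷ v2 ∷ v3 ∷ [])) v3)
                         (eq (f1 fstE (app leastCertE (v0 ∷ v2 ∷ v3 ∷ []))) v1)) v1

  traceIndexE : Expr 2
  traceIndexE = sumE (mul (f1 pow2E v0) (app listedAtE (v0 ∷ v1 ∷ v2 ∷ []))) (add (lit 1) v1)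

  certTestE : ℕ → Expr 2
  certTestE e = isZE (call v0 (lit e) v1)

  -- the test for minimisation searching z = (m , w) with n ≤ m and w a
  -- certificate of convergence of φ^A_e(m), i.e. an element m ≥ n of dom φ^A_e
  domainTestE : ℕ → Expr 2
  domainTestE e = isZE (andE (leE v1 (f1 fstE v0)) (call (f1 sndE v0) (lit e) (f1 fstE v0)))

  module _ (o : ℕ → ℕ) where
    open Semantics o (Validity.checkF o)

    aboveInDomF : ℕ → ℕ → ℕ → ℕ
    aboveInDomF e n z = andF (leF n (fstF z)) (Validity.checkF o (sndF z) e (fstF z))

    opaque
      unfolding triF andF bminF
      domainTestE-meaning : ∀ e z n →
                            sem (domainTestE e) (z ∷ n ∷ []) ≡ isZF (aboveInDomF e n z)
      domainTestE-meaning e z n = refl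

      certTestE-meaning : ∀ e w x →
                          sem (certTestE e) (w ∷ x ∷ []) ≡ isZF (Validity.checkF o w e x)
      certTestE-meaning e w x = refl

      fstE-meaning : ∀ z → sem fstE (z ∷ []) ≡ fstF z
      fstE-meaning z = refl

  opaque
    unfolding triF andF bminF
    traceIndexE-meaning : ∀ n d →
                          Semantics.sem (ov ∅) check∅F traceIndexE (n ∷ d ∷ []) ≡ traceIndexF n d
    traceIndexE-meaning n d = refl

module Main where

  open import Data.Nat
  open import Data.Nat.Properties
  open import Data.Product using (Σ; _,_; proj₁; proj₂)
  open import Data.Unit using (⊤; tt)
  open import Data.Fin using (zero; suc)
  open import Data.Vec using ([]; _∷_)
  open import Relation.Binary.PropositionalEquality
  open Expressions
  open Pairing
  open Truth
  open Checker
  open Certificates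
  open Programs
  open Counting
  open TraceConstruction

  nextC : Code 1 → Code 2
  nextC c = comp c (comp succ (proj zero ∷ []) ∷ [])

  prefixSumC : Code 1 → Code 1
  prefixSumC c = prim (comp c (zer ∷ [])) (comp addC (proj (suc zero) ∷ nextC c ∷ []))

  prefixSumEv : ∀ B c (h : ℕ → ℕ) → (∀ x → Eval B c (x ∷ []) (h x)) →
                ∀ m → Eval B (prefixSumC c) (m ∷ []) (sumF h (suc m))
  prefixSumEv B c h ev zero    = primZ (compE (zerE ∷E []E) (ev 0))
  prefixSumEv B c h ev (suc m) = primS (prefixSumEv B c h ev m)
    (compE (projE (suc zero) ∷E (nextEv ∷E []E)) (addEv B (sumF h (suc m)) (h (suc m))))
    where
      nextEv : Eval B (nextC c) (m ∷ sumF h (suc m) ∷ []) (h (suc m))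
      nextEv = compE (compE (projE zero ∷E []E) succE ∷E []E) (ev (suc m))

  module LeastCertificate (B : Oracle) (c : Code 1) (f : ℕ → ℕ)
                          (ev : ∀ x → Eval B c (x ∷ []) (f x)) where
    open Validity (ov B) using (checkF)

    certificate : ∀ i → Σ ℕ λ w → checkF w (encC c) i ≢ 0
    certificate i with NormalForm.certificate-exists B c i (f i) (ev i)
    ... | w , ok , _ = w , ok

    certF : ℕ → ℕ
    certF i = bminF (λ w → checkF w (encC c) i) (suc (proj₁ (certificate i)))

    cert-ok : ∀ i → checkF (certF i) (encC c) i ≢ 0
    cert-ok i =
      bmin-witness (λ w → checkF w (encC c) i) (proj₁ (certificate i)) (proj₂ (certificate i))

    certC : Code 1
    certC = mu (program orc (certTestE (encC c)))

    certEv : ∀ i → Eval B certC (i ∷ []) (certF i)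
    certEv i = minimisationEv B _ (i ∷ []) (λ w → checkF w (encC c) i)
      (λ w → subst (Eval B _ (w ∷ i ∷ [])) (certTestE-meaning (ov B) (encC c) w i)
                   (programEv B orc (ov B) (λ _ → orcE) (certTestE (encC c)) (w ∷ i ∷ [])))
      (proj₁ (certificate i)) (proj₂ (certificate i))

  -- An infinite set c.e. in A has an A-computable function choosing, for
  -- every n, an element above n: search a pair (m , w) with n ≤ m and w a
  -- certificate that m is in the domain enumerating the set.
  module AboveInSet (A : Oracle) (D : ℕ → Set) (infinite : Infinite D)
                    (ce : CEIn A D) where
    open Validity (ov A) using (checkF)

    e : ℕ
    e = encC (proj₁ ce)

    witness : ∀ n → Σ ℕ λ z → aboveInDomF (ov A) e n z ≢ 0
    witness n with infinite n
    ... | m , n≤m , Dm with proj₁ (proj₂ ce m) Dm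
    ... | y , ev with NormalForm.certificate-exists A (proj₁ ce) m y ev
    ... | w , ok , _ = pairF m w , ok′
      where
        ok′ : aboveInDomF (ov A) e n (pairF m w) ≢ 0
        ok′ rewrite fst-pair m w | snd-pair m w = and-intro (le-intro n m n≤m) ok

    search : ℕ → ℕ
    search n = bminF (aboveInDomF (ov A) e n) (suc (proj₁ (witness n)))

    search-ok : ∀ n → aboveInDomF (ov A) e n (search n) ≢ 0
    search-ok n = bmin-witness (aboveInDomF (ov A) e n) (proj₁ (witness n)) (proj₂ (witness n))

    above : ℕ → ℕ
    above n = fstF (search n)

    n≤above : ∀ n → n ≤ above n
    n≤above n = le-elim n (above n) (and-l (search-ok n))

    above∈D : ∀ n → D (above n)
    above∈D n = proj₂ (proj₂ ce (above n))
      (_ , NormalForm.certificate-sound A (proj₁ ce) (above n) (sndF (search n))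
             (and-r {leF n (above n)} (search-ok n)))

    aboveC : Code 1
    aboveC = comp (program orc fstE) (mu (program orc (domainTestE e)) ∷ [])

    aboveEv : ∀ n → Eval A aboveC (n ∷ []) (above n)
    aboveEv n = compE (searchEv ∷E []E)
      (subst (Eval A _ (search n ∷ [])) (fstE-meaning (ov A) (search n))
             (programEv A orc (ov A) (λ _ → orcE) fstE (search n ∷ [])))
      where
        searchEv : Eval A (mu (program orc (domainTestE e))) (n ∷ []) (search n)
        searchEv = minimisationEv A _ (n ∷ []) (aboveInDomF (ov A) e n)
          (λ z → subst (Eval A _ (z ∷ n ∷ [])) (domainTestE-meaning (ov A) e z n)
                       (programEv A orc (ov A) (λ _ → orcE) (domainTestE e) (z ∷ n ∷ [])))
          (proj₁ (witness n)) (proj₂ (witness n))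

  -- (i) ⇒ (ii): a trace is a partial trace with D = ℕ and bound g(n) = n + 1.
  trace⇒partialTrace : ∀ A → ComputesTraceForAllComputable A →
                       ComputesPartialTraceForAllComputable A
  trace⇒partialTrace A (p , (pC , pEv) , size , traces) = T , partialTraces
    where
      T : PartialTrace A
      T = record
        { D       = λ _ → ⊤
        ; D-inf   = λ m → m , ≤-refl , tt
        ; D-ce    = zer , λ x → (λ _ → 0 , zerE) , (λ _ → tt)
        ; g       = succ
        ; g-dom   = λ { n .(suc n) succE → n≤1+n n }
        ; D⊆domg  = λ n _ → suc n , succE
        ; σ       = pC
        ; D⊆domσ  = λ n _ → p n , pEv n
        ; σ-bound = λ n _ k y σn gn →
            subst₂ (λ a b → ∣D a ∣ < b)
                   (eval-deterministic A (pEv n) σn) (eval-deterministic A succE gn) (s≤s (size n))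
        }
      partialTraces : ∀ f → Computable f → TracesPartial T f
      partialTraces f cf with traces f cf
      ... | N , tr =
        N , λ n N≤n _ k σn → subst (f n ∈D_) (eval-deterministic A (pEv n) σn) (tr n N≤n)

  module FromPartialTrace (A : Oracle) (T : PartialTrace A)
                          (traces : ∀ f → Computable f → TracesPartial T f) where
    open PartialTrace T
    open AboveInSet A D D-inf D-ce
    open Validity (ov ∅) using () renaming (checkF to check∅F)

    d : ℕ → ℕ
    d n = proj₁ (D⊆domσ (above n) (above∈D n))

    dEv : ∀ n → Eval A σ (above n ∷ []) (d n)
    dEv n = proj₂ (D⊆domσ (above n) (above∈D n))

    p : ℕ → ℕ
    p n = traceIndexF n (d n)

    pC : Code 1
    pC = comp (program zer traceIndexE) (proj zero ∷ comp σ (aboveC ∷ []) ∷ [])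

    pEv : ∀ n → Eval A pC (n ∷ []) (p n)
    pEv n = compE (projE zero ∷E (compE (aboveEv n ∷E []E) (dEv n) ∷E []E))
      (subst (Eval A _ (n ∷ d n ∷ [])) (traceIndexE-meaning n (d n))
             (programEv A zer (ov ∅) (λ _ → zerE) traceIndexE (n ∷ d n ∷ [])))

    listedAt≤1 : ∀ n y → listedAtF n (d n) y ≤ 1
    listedAt≤1 n y = bex≤1 _ n

    size : ∀ n → ∣D p n ∣ ≤ n
    size n = ≤-trans (popcount-setIndex (p n) (suc (d n)) (listedAtF n (d n)) (listedAt≤1 n))
                     (listed-count _ _ n (suc (d n)))

    module _ (f : ℕ → ℕ) (c : Code 1) (cEv : ∀ x → Eval ∅ c (x ∷ []) (f x)) where
      open LeastCertificate ∅ c f cEv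

      F : ℕ → ℕ
      F m = sumF certF (suc m)

      F-traced : TracesPartial T F
      F-traced = traces F (prefixSumC certC , prefixSumEv ∅ certC certF certEv)

      N₀ : ℕ
      N₀ = proj₁ F-traced

      F<σ : ∀ m → N₀ ≤ m → D m → ∀ k → σ ⟨ A ⟩[ m ]≃ k → F m < k
      F<σ m N₀≤m Dm k σm = member< (F m) k (proj₂ F-traced m N₀≤m Dm k σm)

      cert<d : ∀ n → N₀ ≤ n → certF n < d n
      cert<d n N₀≤n = begin-strict
        certF n      ≤⟨ summand≤sum certF (suc (above n)) n (s≤s (n≤above n)) ⟩
        F (above n)  <⟨ F<σ (above n) (≤-trans N₀≤n (n≤above n)) (above∈D n) (d n) (dEv n) ⟩
        d n          ∎
        where open ≤-Reasoning

      module AtArgument (n : ℕ) (N₀≤n : N₀ ≤ n) where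
        lc : ℕ
        lc = leastCertF n (d n) (encC c)

        lc≤d : lc ≤ d n
        lc≤d = ≤-trans (bmin-least _ (suc (d n)) (certF n) (cert-ok n)) (<⇒≤ (cert<d n N₀≤n))

        value : fstF lc ≡ f n
        value = eval-deterministic ∅
          (NormalForm.certificate-sound ∅ c n lc (bmin-found _ (suc (d n)) (s≤s lc≤d))) (cEv n)

        f≤d : f n ≤ d n
        f≤d = subst (_≤ d n) value (≤-trans (fst≤ lc) lc≤d)

        listed : encC c < n → listedAtF n (d n) (f n) ≡ 1
        listed e<n = bex-true _ n (bex-intro _ n (encC c) e<n (and-intro (le-intro _ _ lc≤d) hits))
          where
            hits : eqF (fstF lc) (f n) ≢ 0
            hits = subst (λ u → eqF u (f n) ≢ 0) (sym value) (eq-intro (f n))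

      -- f(n) ∈ p(n) as soon as n ≥ N₀ and n exceeds the number of c
      traced : TracesTotal p f
      traced = N₀ + suc (encC c) , λ n N≤n →
        let open AtArgument n (≤-trans (m≤m+n N₀ (suc (encC c))) N≤n) in
        trans (bit-setIndex (f n) (suc (d n)) (listedAtF n (d n)) (listedAt≤1 n) (s≤s f≤d))
              (listed (≤-trans (m≤n+m (suc (encC c)) N₀) N≤n))

    trace : ComputesTraceForAllComputable A
    trace = p , (pC , pEv) , size , λ f (c , cEv) → traced f c cEv

open Main using (trace⇒partialTrace; module FromPartialTrace)

theorem8 : (A : Oracle) →
    ComputesTraceForAllComputable A ⇔ ComputesPartialTraceForAllComputable A
theorem8 A = mk⇔ (trace⇒partialTrace A) (λ (T , traces) → FromPartialTrace.trace A T traces)
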